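{- Let $t$ be a non-negative integer and $n$ a positive integer. Let $M(z)$ be the formal power series (with coefficients polynomials in $\alpha$) satisfying $M(z)=1+2zM(z)+\alpha z^2M(z)^2$. Then $$\frac {\partial} {\partial\alpha}\left(\langle z^n\rangle\frac {\alpha zM(z)\left(\left(zM(z)\right)^t-\left(\frac {z} {1-z}\right)^{t}\right)}{\left(1+\alpha zM(z)\right)\left(1+zM(z)\right)}\right)\Bigg\vert_{\alpha=1}=\binom {2n-5}{n-t-1}+(n-3)\binom {2n-5}{n-t-3}-n\binom {2n-5}{n-t-4}-\binom {n-3}{n-t-1}.$$
   Context: $M(z)$ is the unique formal power series in $z$ with coefficients in $\mathbb Z[\alpha]$ satisfying the stated equation. $\langle z^n\rangle F(z)$ denotes the coefficient of $z^n$ in $F(z)$. Binomial convention: $\binom{a}{k}=a(a-1)\cdots(a-k+1)/k!$ for integers $k\ge0$ (any integer $a$) and $\binom ak=0$ for $k<0$. -}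

module Defs where

open import Data.Nat as ℕ using (ℕ; zero; suc)
open import Data.Nat.Properties using (_!≢0)
open import Data.Integer as ℤ using (ℤ; +_; -[1+_]; _/ℕ_)
open import Data.List using (List; []; _∷_)
open import Relation.Binary.PropositionalEquality using (_≡_)

-- Polynomials in α with integer coefficients: coefficient lists
-- (constant term first). Equality is coefficientwise (so trailing
-- zeros are irrelevant).

Poly : Set
Poly = List ℤ

coeff : Poly → ℕ → ℤ
coeff []      _       = + 0
coeff (c ∷ p) zero    = c
coeff (c ∷ p) (suc k) = coeff p k

_≈ₚ_ : Poly → Poly → Set
p ≈ₚ q = ∀ k → coeff p k ≡ coeff q k

infixl 6 _+ₚ_
infixl 7 _*ₚ_ _·ₚ_

_+ₚ_ : Poly → Poly → Poly
[]      +ₚ q       = q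
(c ∷ p) +ₚ []      = c ∷ p
(c ∷ p) +ₚ (d ∷ q) = (c ℤ.+ d) ∷ (p +ₚ q)

_·ₚ_ : ℤ → Poly → Poly
a ·ₚ []      = []
a ·ₚ (c ∷ p) = (a ℤ.* c) ∷ (a ·ₚ p)

-ₚ_ : Poly → Poly
-ₚ p = ℤ.- (+ 1) ·ₚ p

_*ₚ_ : Poly → Poly → Poly
[]      *ₚ q = []
(c ∷ p) *ₚ q = (c ·ₚ q) +ₚ (+ 0 ∷ (p *ₚ q))

constₚ : ℤ → Poly
constₚ a = a ∷ []

αₚ : Poly
αₚ = + 0 ∷ + 1 ∷ []

derivₚ : Poly → Poly
derivₚ []      = []
derivₚ (c ∷ p) = go 1 p
  where
  go : ℕ → Poly → Poly
  go k []      = []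
  go k (d ∷ q) = (+ k ℤ.* d) ∷ go (suc k) q

eval1 : Poly → ℤ
eval1 []      = + 0
eval1 (c ∷ p) = c ℤ.+ eval1 p

dα-at1 : Poly → ℤ
dα-at1 p = eval1 (derivₚ p)

-- Formal power series in z with coefficients in ℤ[α].
-- A series F is its coefficient function: F n = ⟨zⁿ⟩F.

Series : Set
Series = ℕ → Poly

_≈ₛ_ : Series → Series → Set
F ≈ₛ G = ∀ n → F n ≈ₚ G n

infixl 6 _+ₛ_ _-ₛ_
infixl 7 _*ₛ_ _·ₛ_

_+ₛ_ : Series → Series → Series
(F +ₛ G) n = F n +ₚ G n

_-ₛ_ : Series → Series → Series
(F -ₛ G) n = F n +ₚ (-ₚ G n)

_·ₛ_ : Poly → Series → Series
(p ·ₛ F) n = p *ₚ F n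

_*ₛ_ : Series → Series → Series
(F *ₛ G) n = go n
  where
  go : ℕ → Poly
  go zero    = F zero *ₚ G n
  go (suc i) = go i +ₚ (F (suc i) *ₚ G (n ℕ.∸ suc i))

constₛ : Poly → Series
constₛ p zero    = p
constₛ p (suc n) = []

oneₛ : Series
oneₛ = constₛ (constₚ (+ 1))

zₛ : Series → Series
zₛ F zero    = []
zₛ F (suc n) = F n

_^ₛ_ : Series → ℕ → Series
F ^ₛ zero  = oneₛ
F ^ₛ suc t = F *ₛ (F ^ₛ t)

z/1-z : Series
z/1-z zero    = []
z/1-z (suc n) = constₚ (+ 1)

falling : ℤ → ℕ → ℤ
falling a zero    = + 1
falling a (suc k) = falling a k ℤ.* (a ℤ.- + k)

binomℕ : ℤ → ℕ → ℤ
binomℕ a k = _/ℕ_ (falling a k) (k ℕ.!) {{k !≢0}}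

binom : ℤ → ℤ → ℤ
binom a (+ k)    = binomℕ a k
binom a -[1+ _ ] = + 0

-- At α = 1 the series u = zM satisfies the Catalan equation u = z (1 + u)², and differentiating
-- the defining equations in α expresses ∂(zM)/∂α and ∂Q/∂α at α = 1 rationally in u, t and
-- w = z / (1 - z). With θ = z d/dz, the claimed numbers are the coefficients of
-- S(t+1) + θS(t+3) - 3 S(t+3) - θS(t+4) - E(t), where S(j) = Σ binom(2n-5, n-j) zⁿ and
-- E(t) = Σ binom(n-3, n-t-1) zⁿ. Pascal's rule gives E(t) = z (1 - z) wᵗ and, starting from
-- Σ binom(2n, n) zⁿ = (1 + u) / (1 - u) (both sides solve the same first-order equation in θ),
-- S(j) = uʲ / ((1 - u) (1 + u)⁴). Multiplied by (1 - u)³ (1 + u)⁴, a series with constant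
-- term 1, the two sides become the same polynomial expression in u, z, uᵗ, wᵗ and t.
module Submission where

open import Defs
open import Data.Nat using (ℕ; _≤_)
open import Data.Integer using (ℤ; +_; _+_; _-_; _*_)
open import Relation.Binary.PropositionalEquality using (_≡_)

open import Level using (0ℓ)
open import Data.Nat as ℕ using (zero; suc; _∸_; _<_; z≤n; s≤s; _!)
import Data.Nat.Properties as ℕP
import Data.Nat.DivMod as ℕD
open import Data.Integer as ℤ using (-_; -[1+_]; _/ℕ_)
import Data.Integer.Properties as ℤP
open import Data.Integer.Tactic.RingSolver using (solve-∀)
open import Data.List using ([]; _∷_)
open import Data.Maybe using (Maybe; just; nothing)
open import Data.Product using (Σ; _,_; _×_; proj₁)
open import Data.Sum using (inj₁; inj₂)
open import Relation.Nullary using (yes; no; contradiction)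
open import Relation.Binary.PropositionalEquality
  using (_≢_; refl; sym; trans; cong; cong₂; subst; _≗_; module ≡-Reasoning)
open import Relation.Binary.Bundles using (Setoid)
import Relation.Binary.Reasoning.Setoid as SetoidReasoning
open import Algebra.Bundles using (CommutativeRing)
open import Algebra.Consequences.Setoid using (comm∧idˡ⇒id; comm∧invˡ⇒inv; comm∧distrʳ⇒distr)
import Algebra.Solver.Ring
import Algebra.Solver.Ring.AlmostCommutativeRing as ACR

-- The ring ℤ⟦z⟧ of formal power series with integer coefficients

ℤ⟦z⟧ : Set
ℤ⟦z⟧ = ℕ → ℤ

infix  4 _≈_
infixl 6 _⊕_ _⊖_
infixl 7 _⊛_ _·_
infix  8 ⊝_
infixr 9 _^_

_≈_ : ℤ⟦z⟧ → ℤ⟦z⟧ → Set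
_≈_ = _≗_

_⊕_ : ℤ⟦z⟧ → ℤ⟦z⟧ → ℤ⟦z⟧
(f ⊕ g) n = f n + g n

⊝_ : ℤ⟦z⟧ → ℤ⟦z⟧
(⊝ f) n = - f n

_⊖_ : ℤ⟦z⟧ → ℤ⟦z⟧ → ℤ⟦z⟧
f ⊖ g = f ⊕ ⊝ g

_·_ : ℤ → ℤ⟦z⟧ → ℤ⟦z⟧
(c · f) n = c * f n

cst : ℤ → ℤ⟦z⟧
cst c zero    = c
cst c (suc n) = + 0

-- 𝟘 is `cst (+ 0)` rather than `λ _ → + 0` because that is how the ring solver interprets
-- `con (+ 0)`.
𝟘 𝟙 : ℤ⟦z⟧
𝟘 = cst (+ 0)
𝟙 = cst (+ 1)

𝟘-coeff : ∀ n → 𝟘 n ≡ + 0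
𝟘-coeff zero    = refl
𝟘-coeff (suc n) = refl

tail : ℤ⟦z⟧ → ℤ⟦z⟧
tail f n = f (suc n)

_⊛_ : ℤ⟦z⟧ → ℤ⟦z⟧ → ℤ⟦z⟧
(f ⊛ g) zero    = f 0 * g 0
(f ⊛ g) (suc n) = f 0 * g (suc n) + (tail f ⊛ g) n

_^_ : ℤ⟦z⟧ → ℕ → ℤ⟦z⟧
f ^ zero  = 𝟙
f ^ suc k = f ⊛ f ^ k

≈-refl : ∀ {f} → f ≈ f
≈-refl _ = refl

≈-sym : ∀ {f g} → f ≈ g → g ≈ f
≈-sym p n = sym (p n)

≈-trans : ∀ {f g h} → f ≈ g → g ≈ h → f ≈ h
≈-trans p q n = trans (p n) (q n)

⊕-cong : ∀ {f f′ g g′} → f ≈ f′ → g ≈ g′ → f ⊕ g ≈ f′ ⊕ g′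
⊕-cong p q n = cong₂ _+_ (p n) (q n)

⊝-cong : ∀ {f f′} → f ≈ f′ → ⊝ f ≈ ⊝ f′
⊝-cong p n = cong -_ (p n)

⊕-comm : ∀ f g → f ⊕ g ≈ g ⊕ f
⊕-comm f g n = ℤP.+-comm (f n) (g n)

⊕-identityˡ : ∀ f → 𝟘 ⊕ f ≈ f
⊕-identityˡ f n = trans (cong (_+ f n) (𝟘-coeff n)) (ℤP.+-identityˡ (f n))

⊕-inverseˡ : ∀ f → ⊝ f ⊕ f ≈ 𝟘
⊕-inverseˡ f n = trans (ℤP.+-inverseˡ (f n)) (sym (𝟘-coeff n))

⊛-cong : ∀ {f f′ g g′} → f ≈ f′ → g ≈ g′ → f ⊛ g ≈ f′ ⊛ g′
⊛-cong p q zero    = cong₂ _*_ (p 0) (q 0)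
⊛-cong p q (suc n) = cong₂ _+_ (cong₂ _*_ (p 0) (q (suc n))) (⊛-cong (λ m → p (suc m)) q n)

⊛-vanishesˡ : ∀ {f} → (∀ n → f n ≡ + 0) → ∀ g n → (f ⊛ g) n ≡ + 0
⊛-vanishesˡ f≡0 g zero    = cong (_* g 0) (f≡0 0)
⊛-vanishesˡ f≡0 g (suc n) =
  cong₂ _+_ (cong (_* g (suc n)) (f≡0 0)) (⊛-vanishesˡ (λ m → f≡0 (suc m)) g n)

cst⊛ : ∀ c g → cst c ⊛ g ≈ c · g
cst⊛ c g zero    = refl
cst⊛ c g (suc n) =
  trans (cong (_+_ (c * g (suc n))) (⊛-vanishesˡ (λ _ → refl) g n)) (ℤP.+-identityʳ _)

⊛-zeroˡ : ∀ g → 𝟘 ⊛ g ≈ 𝟘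
⊛-zeroˡ g n = trans (cst⊛ (+ 0) g n) (sym (𝟘-coeff n))

⊛-identityˡ : ∀ g → 𝟙 ⊛ g ≈ g
⊛-identityˡ g n = trans (cst⊛ (+ 1) g n) (ℤP.*-identityˡ (g n))

⊛-distribʳ : ∀ h f g → (f ⊕ g) ⊛ h ≈ f ⊛ h ⊕ g ⊛ h
⊛-distribʳ h f g zero    = ℤP.*-distribʳ-+ (h 0) (f 0) (g 0)
⊛-distribʳ h f g (suc n) = begin
  (f 0 + g 0) * h (suc n) + ((tail f ⊕ tail g) ⊛ h) n
    ≡⟨ cong₂ _+_ (ℤP.*-distribʳ-+ (h (suc n)) (f 0) (g 0)) (⊛-distribʳ h (tail f) (tail g) n) ⟩
  (f 0 * h (suc n) + g 0 * h (suc n)) + ((tail f ⊛ h) n + (tail g ⊛ h) n)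
    ≡⟨ interchange (f 0 * h (suc n)) (g 0 * h (suc n)) ((tail f ⊛ h) n) ((tail g ⊛ h) n) ⟩
  (f 0 * h (suc n) + (tail f ⊛ h) n) + (g 0 * h (suc n) + (tail g ⊛ h) n) ∎
  where
  open ≡-Reasoning
  interchange : ∀ a b c d → (a + b) + (c + d) ≡ (a + c) + (b + d)
  interchange = solve-∀

·-⊛ : ∀ c f g → (c · f) ⊛ g ≈ c · (f ⊛ g)
·-⊛ c f g zero    = ℤP.*-assoc c (f 0) (g 0)
·-⊛ c f g (suc n) = trans (cong₂ _+_ (ℤP.*-assoc c (f 0) (g (suc n))) (·-⊛ c (tail f) g n))
                          (sym (ℤP.*-distribˡ-+ c (f 0 * g (suc n)) ((tail f ⊛ g) n)))

⊛-assoc : ∀ f g h → (f ⊛ g) ⊛ h ≈ f ⊛ (g ⊛ h)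
⊛-assoc f g h zero    = ℤP.*-assoc (f 0) (g 0) (h 0)
⊛-assoc f g h (suc n) = begin
  f0g0 * h (suc n) + (tail (f ⊛ g) ⊛ h) n
    ≡⟨ cong (_+_ (f0g0 * h (suc n))) (⊛-distribʳ h (f 0 · tail g) (tail f ⊛ g) n) ⟩
  f0g0 * h (suc n) + (((f 0 · tail g) ⊛ h) n + ((tail f ⊛ g) ⊛ h) n)
    ≡⟨ cong (_+_ (f0g0 * h (suc n))) (cong₂ _+_ (·-⊛ (f 0) (tail g) h n) (⊛-assoc (tail f) g h n)) ⟩
  f0g0 * h (suc n) + (f 0 * (tail g ⊛ h) n + (tail f ⊛ (g ⊛ h)) n)
    ≡⟨ regroup (f 0) (g 0) (h (suc n)) ((tail g ⊛ h) n) ((tail f ⊛ (g ⊛ h)) n) ⟩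
  f 0 * (g 0 * h (suc n) + (tail g ⊛ h) n) + (tail f ⊛ (g ⊛ h)) n ∎
  where
  open ≡-Reasoning
  f0g0 = f 0 * g 0
  regroup : ∀ a b c d e → (a * b) * c + (a * d + e) ≡ a * (b * c + d) + e
  regroup = solve-∀

⊛-comm : ∀ f g → f ⊛ g ≈ g ⊛ f
⊛-comm f g zero          = ℤP.*-comm (f 0) (g 0)
⊛-comm f g (suc zero)    = trans (cong₂ _+_ (ℤP.*-comm (f 0) (g 1)) (ℤP.*-comm (f 1) (g 0)))
                                 (ℤP.+-comm (g 1 * f 0) (g 0 * f 1))
⊛-comm f g (suc (suc n)) = begin
  f0g + (tail f ⊛ g) (suc n)                    ≡⟨ cong (_+_ f0g) (⊛-comm (tail f) g (suc n)) ⟩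
  f0g + (g0f + (tail g ⊛ tail f) n)             ≡⟨ cong (λ x → f0g + (g0f + x)) (⊛-comm (tail g) (tail f) n) ⟩
  f0g + (g0f + (tail f ⊛ tail g) n)             ≡⟨ swap f0g g0f ((tail f ⊛ tail g) n) ⟩
  g0f + (f0g + (tail f ⊛ tail g) n)             ≡⟨ cong (_+_ g0f) (⊛-comm f (tail g) (suc n)) ⟩
  g0f + (tail g ⊛ f) (suc n)                    ∎
  where
  open ≡-Reasoning
  f0g = f 0 * g (2 ℕ.+ n)
  g0f = g 0 * f (2 ℕ.+ n)
  swap : ∀ a b c → a + (b + c) ≡ b + (a + c)
  swap = solve-∀

ℤ⟦z⟧-setoid : Setoid 0ℓ 0ℓ
ℤ⟦z⟧-setoid = record
  { Carrier = ℤ⟦z⟧ ; _≈_ = _≈_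
  ; isEquivalence = record { refl = ≈-refl ; sym = ≈-sym ; trans = ≈-trans } }

module ≈-Reasoning = SetoidReasoning ℤ⟦z⟧-setoid

ℤ⟦z⟧-commutativeRing : CommutativeRing 0ℓ 0ℓ
ℤ⟦z⟧-commutativeRing = record
  { Carrier = ℤ⟦z⟧ ; _≈_ = _≈_ ; _+_ = _⊕_ ; _*_ = _⊛_ ; -_ = ⊝_ ; 0# = 𝟘 ; 1# = 𝟙
  ; isCommutativeRing = record
    { isRing = record
      { +-isAbelianGroup = record
        { isGroup = record
          { isMonoid = record
            { isSemigroup = record
              { isMagma = record { isEquivalence = Setoid.isEquivalence ℤ⟦z⟧-setoid ; ∙-cong = ⊕-cong }
              ; assoc   = λ f g h n → ℤP.+-assoc (f n) (g n) (h n) }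
            ; identity = comm∧idˡ⇒id ℤ⟦z⟧-setoid ⊕-comm ⊕-identityˡ }
          ; inverse = comm∧invˡ⇒inv ℤ⟦z⟧-setoid ⊕-comm ⊕-inverseˡ
          ; ⁻¹-cong = ⊝-cong }
        ; comm = ⊕-comm }
      ; *-cong     = ⊛-cong
      ; *-assoc    = ⊛-assoc
      ; *-identity = comm∧idˡ⇒id ℤ⟦z⟧-setoid ⊛-comm ⊛-identityˡ
      ; distrib    = comm∧distrʳ⇒distr ℤ⟦z⟧-setoid ⊕-cong ⊛-comm ⊛-distribʳ }
    ; *-comm = ⊛-comm } }

⊛-identityʳ : ∀ f → f ⊛ 𝟙 ≈ f
⊛-identityʳ f = ≈-trans (⊛-comm f 𝟙) (⊛-identityˡ f)

⊛-zeroʳ : ∀ f → f ⊛ 𝟘 ≈ 𝟘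
⊛-zeroʳ f = ≈-trans (⊛-comm f 𝟘) (⊛-zeroˡ f)

^-+ : ∀ f m n → f ^ (m ℕ.+ n) ≈ f ^ m ⊛ f ^ n
^-+ f zero    n = ≈-sym (⊛-identityˡ (f ^ n))
^-+ f (suc m) n = ≈-trans (⊛-cong ≈-refl (^-+ f m n)) (≈-sym (⊛-assoc f (f ^ m) (f ^ n)))

^-constant-term : ∀ {f} → f 0 ≡ + 1 → ∀ k → (f ^ k) 0 ≡ + 1
^-constant-term f0≡1 zero    = refl
^-constant-term f0≡1 (suc k) = cong₂ _*_ f0≡1 (^-constant-term f0≡1 k)

cst-homomorphism : CommutativeRing.rawRing ℤP.+-*-commutativeRing
                     ACR.-Raw-AlmostCommutative⟶ ACR.fromCommutativeRing ℤ⟦z⟧-commutativeRing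
cst-homomorphism = record
  { ⟦_⟧    = cst
  ; +-homo = λ a b → λ { zero → refl ; (suc n) → refl }
  ; *-homo = λ a b → λ { zero → refl
                       ; (suc n) → sym (trans (cst⊛ a (cst b) (suc n)) (ℤP.*-zeroʳ a)) }
  ; -‿homo = λ a → λ { zero → refl ; (suc n) → refl }
  ; 0-homo = λ { zero → refl ; (suc n) → refl }
  ; 1-homo = λ { zero → refl ; (suc n) → refl }
  }

cst-+ : ∀ a b → cst (a + b) ≈ cst a ⊕ cst b
cst-+ = ACR._-Raw-AlmostCommutative⟶_.+-homo cst-homomorphism

cst-≟ : ∀ a b → Maybe (cst a ≈ cst b)
cst-≟ a b with a ℤ.≟ b
... | yes refl = just ≈-refl
... | no _     = nothing

module ℤ⟦z⟧-Solver = Algebra.Solver.Ring (CommutativeRing.rawRing ℤP.+-*-commutativeRing)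
  (ACR.fromCommutativeRing ℤ⟦z⟧-commutativeRing) cst-homomorphism cst-≟

open ℤ⟦z⟧-Solver using (solve; _:=_; _:+_; _:-_; _:*_; :-_; _:^_; con)

infix  5 _by_
infixl 4 _⊹_

-- Deduction by linear combination: if a₀ ⊖ b₀ equals Σ cᵢ ⊛ (aᵢ ⊖ bᵢ) as a ring identity
-- (checked by `solve`) and each aᵢ ≈ bᵢ holds, then a₀ ≈ b₀.
_by_ : ∀ {a b} (c : ℤ⟦z⟧) → a ≈ b → c ⊛ (a ⊖ b) ≈ 𝟘
_by_ {a} {b} c a≈b = ≈-trans (⊛-cong (≈-refl {c}) a-b≈𝟘) (⊛-zeroʳ c)
  where
  a-b≈𝟘 : a ⊖ b ≈ 𝟘
  a-b≈𝟘 n = trans (cong (_- b n) (a≈b n)) (trans (ℤP.+-inverseʳ (b n)) (sym (𝟘-coeff n)))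

_⊹_ : ∀ {y y′} → y ≈ 𝟘 → y′ ≈ 𝟘 → y ⊕ y′ ≈ 𝟘
(p ⊹ q) n = trans (cong₂ _+_ (trans (p n) (𝟘-coeff n)) (q n)) (ℤP.+-identityˡ (𝟘 n))

linear-combination : ∀ {a b y} → y ≈ 𝟘 → a ⊖ b ≈ y → a ≈ b
linear-combination {a} {b} y≈𝟘 a-b≈y n =
  ℤP.i-j≡0⇒i≡j (a n) (b n) (trans (a-b≈y n) (trans (y≈𝟘 n) (𝟘-coeff n)))

-- The series z, and cancellation

z : ℤ⟦z⟧
z 1 = + 1
z _ = + 0

z⊛-suc : ∀ f n → (z ⊛ f) (suc n) ≡ f n
z⊛-suc f n = trans (ℤP.+-identityˡ _) (trans (⊛-cong tail-z ≈-refl n) (⊛-identityˡ f n))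
  where
  tail-z : tail z ≈ 𝟙
  tail-z zero    = refl
  tail-z (suc n) = refl

z⊛-cancel : ∀ {f g} → z ⊛ f ≈ z ⊛ g → f ≈ g
z⊛-cancel {f} {g} zf≈zg n = trans (sym (z⊛-suc f n)) (trans (zf≈zg (suc n)) (z⊛-suc g n))

⊛-vanishesʳ : ∀ f {g} n → (∀ m → m ≤ n → g m ≡ + 0) → (f ⊛ g) n ≡ + 0
⊛-vanishesʳ f zero    g≤0 = trans (cong (f 0 *_) (g≤0 0 z≤n)) (ℤP.*-zeroʳ (f 0))
⊛-vanishesʳ f (suc n) g≤n =
  cong₂ _+_ (trans (cong (f 0 *_) (g≤n (suc n) ℕP.≤-refl)) (ℤP.*-zeroʳ (f 0)))
            (⊛-vanishesʳ (tail f) n (λ m m≤n → g≤n m (ℕP.m≤n⇒m≤1+n m≤n)))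

≈𝟘-by-induction : ∀ {g} → g 0 ≡ + 0 →
                  (∀ n → (∀ m → m ≤ n → g m ≡ + 0) → g (suc n) ≡ + 0) → g ≈ 𝟘
≈𝟘-by-induction {g} g0≡0 step n = trans (vanishes-upto n n ℕP.≤-refl) (sym (𝟘-coeff n))
  where
  vanishes-upto : ∀ n m → m ≤ n → g m ≡ + 0
  vanishes-upto zero    zero _     = g0≡0
  vanishes-upto (suc n) m    m≤1+n with ℕP.m≤n⇒m<n∨m≡n m≤1+n
  ... | inj₁ (s≤s m≤n) = vanishes-upto n m m≤n
  ... | inj₂ refl      = step n (vanishes-upto n)

⊛-cancelˡ : ∀ {f g h} → f 0 ≢ + 0 → f ⊛ g ≈ f ⊛ h → g ≈ h
⊛-cancelˡ {f} {g} {h} f0≢0 fg≈fh = linear-combination (≈𝟘-by-induction d0≡0 step) ≈-refl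
  where
  d = g ⊖ h
  fd≈𝟘 : f ⊛ d ≈ 𝟘
  fd≈𝟘 n = trans (distrib n) (trans (cong (_- (f ⊛ h) n) (fg≈fh n))
                                    (trans (ℤP.+-inverseʳ ((f ⊛ h) n)) (sym (𝟘-coeff n))))
    where
    distrib : f ⊛ (g ⊖ h) ≈ f ⊛ g ⊖ f ⊛ h
    distrib = solve 3 (λ f g h → f :* (g :- h) := f :* g :- f :* h) ≈-refl f g h
  cancel-f0 : ∀ {x} → f 0 * x ≡ + 0 → x ≡ + 0
  cancel-f0 f0x≡0 with ℤP.i*j≡0⇒i≡0∨j≡0 (f 0) f0x≡0
  ... | inj₁ f0≡0 = contradiction f0≡0 f0≢0
  ... | inj₂ x≡0  = x≡0
  d0≡0 : d 0 ≡ + 0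
  d0≡0 = cancel-f0 (fd≈𝟘 0)
  step : ∀ n → (∀ m → m ≤ n → d m ≡ + 0) → d (suc n) ≡ + 0
  step n d≤n = cancel-f0 (trans (sym (ℤP.+-identityʳ _))
    (trans (cong (_+_ (f 0 * d (suc n))) (sym (⊛-vanishesʳ (tail f) n d≤n))) (fd≈𝟘 (suc n))))

-- The Euler operator θ = z d/dz

θ : ℤ⟦z⟧ → ℤ⟦z⟧
θ f n = + n * f n

θ-cong : ∀ {f g} → f ≈ g → θ f ≈ θ g
θ-cong f≈g n = cong (+ n *_) (f≈g n)

θ-⊕ : ∀ f g → θ (f ⊕ g) ≈ θ f ⊕ θ g
θ-⊕ f g n = ℤP.*-distribˡ-+ (+ n) (f n) (g n)

θ-⊝ : ∀ f → θ (⊝ f) ≈ ⊝ θ f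
θ-⊝ f n = sym (ℤP.neg-distribʳ-* (+ n) (f n))

θ-⊖ : ∀ f g → θ (f ⊖ g) ≈ θ f ⊖ θ g
θ-⊖ f g = ≈-trans (θ-⊕ f (⊝ g)) (⊕-cong (≈-refl {θ f}) (θ-⊝ g))

θ-cst : ∀ c → θ (cst c) ≈ 𝟘
θ-cst c zero    = refl
θ-cst c (suc n) = ℤP.*-zeroʳ (+ suc n)

θ-cst⊕ : ∀ c f → θ (cst c ⊕ f) ≈ θ f
θ-cst⊕ c f = ≈-trans (θ-⊕ (cst c) f) (≈-trans (⊕-cong (θ-cst c) ≈-refl) (⊕-identityˡ (θ f)))

θ-cst⊖ : ∀ c f → θ (cst c ⊖ f) ≈ ⊝ θ f
θ-cst⊖ c f = ≈-trans (θ-cst⊕ c (⊝ f)) (θ-⊝ f)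

θ-z : θ z ≈ z
θ-z zero          = refl
θ-z (suc zero)    = refl
θ-z (suc (suc n)) = ℤP.*-zeroʳ (+ suc (suc n))

tail-θ : ∀ f → tail (θ f) ≈ θ (tail f) ⊕ tail f
tail-θ f n = suc-distrib (+ n) (f (suc n))
  where
  suc-distrib : ∀ m x → (+ 1 + m) * x ≡ m * x + x
  suc-distrib = solve-∀

θ-⊛ : ∀ f g → θ (f ⊛ g) ≈ θ f ⊛ g ⊕ f ⊛ θ g
θ-⊛ f g zero    = sym (trans (ℤP.+-identityˡ (f 0 * (+ 0 * g 0))) (ℤP.*-zeroʳ (f 0)))
θ-⊛ f g (suc n) = begin
  + suc n * (f 0 * g (suc n) + F n)
    ≡⟨ expand (+ n) (f 0) (g (suc n)) (F n) ⟩
  f0θg + (θ F n + F n)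
    ≡⟨ cong (λ x → f0θg + (x + F n)) (θ-⊛ (tail f) g n) ⟩
  f0θg + (((θ (tail f) ⊛ g) n + (tail f ⊛ θ g) n) + F n)
    ≡⟨ regroup f0θg ((θ (tail f) ⊛ g) n) ((tail f ⊛ θ g) n) (F n) ⟩
  (+ 0 + ((θ (tail f) ⊛ g) n + F n)) + (f0θg + (tail f ⊛ θ g) n)
    ≡⟨ cong (λ x → (+ 0 + x) + (f0θg + (tail f ⊛ θ g) n)) tail-θf⊛g ⟨
  (θ f ⊛ g) (suc n) + (f ⊛ θ g) (suc n) ∎
  where
  open ≡-Reasoning
  F    = tail f ⊛ g
  f0θg = f 0 * θ g (suc n)
  expand : ∀ m a b c → (+ 1 + m) * (a * b + c) ≡ a * ((+ 1 + m) * b) + (m * c + c)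
  expand = solve-∀
  regroup : ∀ a b c d → a + ((b + c) + d) ≡ (+ 0 + (b + d)) + (a + c)
  regroup = solve-∀
  tail-θf⊛g : (tail (θ f) ⊛ g) n ≡ (θ (tail f) ⊛ g) n + F n
  tail-θf⊛g = trans (⊛-cong (tail-θ f) ≈-refl n) (⊛-distribʳ g (θ (tail f)) (tail f) n)

θ-^ : ∀ f k → θ (f ^ suc k) ≈ cst (+ suc k) ⊛ f ^ k ⊛ θ f
θ-^ f zero    = linear-combination (𝟙 by θ-⊛ f 𝟙 ⊹ f by θ-cst (+ 1))
  (solve 4 (λ f θf θ𝟙 θf¹ →
      θf¹ :- con (+ 1) :* con (+ 1) :* θf
   := con (+ 1) :* (θf¹ :- (θf :* con (+ 1) :+ f :* θ𝟙)) :+ f :* (θ𝟙 :- con (+ 0)))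
    ≈-refl f (θ f) (θ 𝟙) (θ (f ⊛ 𝟙)))
θ-^ f (suc k) = linear-combination
  (𝟙 by θ-⊛ f (f ^ suc k) ⊹ f by θ-^ f k ⊹ ⊝ (f ⊛ f ^ k ⊛ θ f) by cst-+ (+ 1) (+ suc k))
  (solve 7 (λ f θf fᵏ θfᵏ⁺¹ θfᵏ⁺² k+1 k+2 →
      θfᵏ⁺² :- k+2 :* (f :* fᵏ) :* θf
   := con (+ 1) :* (θfᵏ⁺² :- (θf :* (f :* fᵏ) :+ f :* θfᵏ⁺¹)) :+ f :* (θfᵏ⁺¹ :- k+1 :* fᵏ :* θf)
      :+ :- (f :* fᵏ :* θf) :* (k+2 :- (con (+ 1) :+ k+1)))
    ≈-refl f (θ f) (f ^ k) (θ (f ^ suc k)) (θ (f ^ suc (suc k))) (cst (+ suc k)) (cst (+ suc (suc k))))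

θ-equation-vanishing : ∀ {K y} → K 0 ≡ + 0 → y 0 ≡ + 0 → θ y ≈ K ⊛ (θ y ⊕ y) → y ≈ 𝟘
θ-equation-vanishing {K} {y} K0≡0 y0≡0 eq = ≈𝟘-by-induction y0≡0 step
  where
  step : ∀ n → (∀ m → m ≤ n → y m ≡ + 0) → y (suc n) ≡ + 0
  step n y≤n = ℤP.*-cancelˡ-≡ (+ suc n) (y (suc n)) (+ 0) (begin
    + suc n * y (suc n)                                ≡⟨ eq (suc n) ⟩
    K 0 * (θ y ⊕ y) (suc n) + (tail K ⊛ (θ y ⊕ y)) n
      ≡⟨ cong₂ _+_ (cong (_* (θ y ⊕ y) (suc n)) K0≡0) (⊛-vanishesʳ (tail K) n θy+y≤n) ⟩
    + 0                                                ≡⟨ ℤP.*-zeroʳ (+ suc n) ⟨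
    + suc n * + 0                                      ∎)
    where
    open ≡-Reasoning
    θy+y≤n : ∀ m → m ≤ n → (θ y ⊕ y) m ≡ + 0
    θy+y≤n m m≤n = trans (cong (λ x → + m * x + x) (y≤n m m≤n)) (cong (_+ + 0) (ℤP.*-zeroʳ (+ m)))

θ-equation-unique : ∀ {K f g} → K 0 ≡ + 0 → f 0 ≡ g 0 →
                    θ f ≈ K ⊛ (θ f ⊕ f) → θ g ≈ K ⊛ (θ g ⊕ g) → f ≈ g
θ-equation-unique {K} {f} {g} K0≡0 f0≡g0 eqf eqg = linear-combination
  (θ-equation-vanishing K0≡0 (trans (cong (_- g 0) f0≡g0) (ℤP.+-inverseʳ (g 0))) eq) ≈-refl
  where
  eq : θ (f ⊖ g) ≈ K ⊛ (θ (f ⊖ g) ⊕ (f ⊖ g))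
  eq = linear-combination (𝟙 ⊖ K by θ-⊖ f g ⊹ 𝟙 by eqf ⊹ ⊝ 𝟙 by eqg)
    (solve 6 (λ K f g θf θg θ[f-g] →
        θ[f-g] :- K :* (θ[f-g] :+ (f :- g))
     := (con (+ 1) :- K) :* (θ[f-g] :- (θf :- θg)) :+ con (+ 1) :* (θf :- K :* (θf :+ f))
        :+ :- con (+ 1) :* (θg :- K :* (θg :+ g)))
      ≈-refl K f g (θ f) (θ g) (θ (f ⊖ g)))

-- Binomial coefficients with integer upper index

falling-suc : ∀ a k → falling a (suc k) ≡ a * falling (a - + 1) k
falling-suc a zero    = trans (ℤP.*-identityˡ (a - + 0)) (trans (ℤP.+-identityʳ a) (sym (ℤP.*-identityʳ a)))
falling-suc a (suc k) =
  trans (cong (_* (a - + suc k)) (falling-suc a k)) (shift a (falling (a - + 1) k) (+ k))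
  where
  shift : ∀ a p k → (a * p) * (a - (+ 1 + k)) ≡ a * (p * ((a - + 1) - k))
  shift = solve-∀

falling-pascal : ∀ a k → falling a (suc k) ≡ falling (a - + 1) (suc k) + + suc k * falling (a - + 1) k
falling-pascal a k = trans (falling-suc a k) (split a (falling (a - + 1) k) (+ k))
  where
  split : ∀ a p k → a * p ≡ p * ((a - + 1) - k) + (+ 1 + k) * p
  split = solve-∀

ℤ-induction : (P : ℤ → Set) → P (+ 0) →
              (∀ a → P a → P (a + + 1)) → (∀ a → P a → P (a - + 1)) → ∀ a → P a
ℤ-induction P P0 up down (+ zero)     = P0
ℤ-induction P P0 up down (+ suc m)    =
  subst P (cong +_ (ℕP.+-comm m 1)) (up (+ m) (ℤ-induction P P0 up down (+ m)))
ℤ-induction P P0 up down -[1+ zero ]  = down (+ 0) P0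
ℤ-induction P P0 up down -[1+ suc m ] =
  subst P (cong (λ x → -[1+ suc x ]) (ℕP.+-identityʳ m)) (down -[1+ m ] (ℤ-induction P P0 up down -[1+ m ]))

k!-divides-falling : ∀ k a → Σ ℤ λ c → falling a k ≡ c * + (k !)
k!-divides-falling zero    a = + 1 , refl
k!-divides-falling (suc k) a =
  let c , eq = ℤ-induction P (+ 0 , falling-suc (+ 0) k) up down a
  in  c , trans eq (cong (c *_) (sym (ℤP.pos-* (suc k) (k !))))
  where
  P : ℤ → Set
  P a = Σ ℤ λ c → falling a (suc k) ≡ c * (+ suc k * + (k !))
  up : ∀ a → P a → P (a + + 1)
  up a (c , eqc) with k!-divides-falling k a
  ... | d , eqd = c + d , (begin
    falling (a + + 1) (suc k)                         ≡⟨ falling-pascal (a + + 1) k ⟩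
    falling (a + + 1 - + 1) (suc k) + + suc k * falling (a + + 1 - + 1) k
      ≡⟨ cong (λ x → falling x (suc k) + + suc k * falling x k) (cancel a) ⟩
    falling a (suc k) + + suc k * falling a k         ≡⟨ cong₂ (λ x y → x + + suc k * y) eqc eqd ⟩
    c * (+ suc k * + (k !)) + + suc k * (d * + (k !)) ≡⟨ combine c d (+ suc k) (+ (k !)) ⟩
    (c + d) * (+ suc k * + (k !))                     ∎)
    where
    open ≡-Reasoning
    cancel : ∀ a → a + + 1 - + 1 ≡ a
    cancel = solve-∀
    combine : ∀ c d s f → c * (s * f) + s * (d * f) ≡ (c + d) * (s * f)
    combine = solve-∀
  down : ∀ a → P a → P (a - + 1)
  down a (c , eqc) with k!-divides-falling k (a - + 1)
  ... | d , eqd = c - d , (begin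
    falling (a - + 1) (suc k)
      ≡⟨ move (falling (a - + 1) (suc k)) (+ suc k * falling (a - + 1) k) ⟩
    falling (a - + 1) (suc k) + + suc k * falling (a - + 1) k - + suc k * falling (a - + 1) k
      ≡⟨ cong (_- + suc k * falling (a - + 1) k) (falling-pascal a k) ⟨
    falling a (suc k) - + suc k * falling (a - + 1) k ≡⟨ cong₂ (λ x y → x - + suc k * y) eqc eqd ⟩
    c * (+ suc k * + (k !)) - + suc k * (d * + (k !)) ≡⟨ combine c d (+ suc k) (+ (k !)) ⟩
    (c - d) * (+ suc k * + (k !))                     ∎)
    where
    open ≡-Reasoning
    move : ∀ x y → x ≡ x + y - y
    move = solve-∀
    combine : ∀ c d s f → c * (s * f) - s * (d * f) ≡ (c - d) * (s * f)
    combine = solve-∀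

/ℕ-exact : ∀ c d .{{_ : ℕ.NonZero d}} → (c * + d) /ℕ d ≡ c
/ℕ-exact (+ m)      (suc d) =
  trans (cong (_/ℕ suc d) (sym (ℤP.pos-* m (suc d)))) (cong +_ (ℕD.m*n/n≡m m (suc d)))
/ℕ-exact -[1+ m ] d@(suc _) = negative refl
  where
  negative : ∀ {n} → suc n ≡ suc m ℕ.* d → -[1+ n ] /ℕ d ≡ -[1+ m ]
  negative {n} eq with suc n ℕ.% d in rem
  ... | zero  = cong (λ x → - (+ x)) (trans (cong (ℕ._/ d) eq) (ℕD.m*n/n≡m (suc m) d))
  ... | suc r = contradiction (trans (sym (ℕD.m*n%n≡0 (suc m) d)) (trans (cong (ℕ._% d) (sym eq)) rem))
                              ℕP.0≢1+n

binomℕ-falling : ∀ a k → binomℕ a k * + (k !) ≡ falling a k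
binomℕ-falling a k with k!-divides-falling k a
... | c , eq = trans (cong (_* + (k !)) c≡binom) (sym eq)
  where
  c≡binom : binomℕ a k ≡ c
  c≡binom = trans (cong (λ x → _/ℕ_ x (k !) {{k ℕP.!≢0}}) eq) (/ℕ-exact c (k !) {{k ℕP.!≢0}})

*k!-cancel : ∀ k {x y} → x * + (k !) ≡ y * + (k !) → x ≡ y
*k!-cancel k {x} {y} = ℤP.*-cancelʳ-≡ x y (+ (k !)) {{k ℕP.!≢0}}

binomℕ-pascal : ∀ a k → binomℕ a (suc k) ≡ binomℕ (a - + 1) (suc k) + binomℕ (a - + 1) k
binomℕ-pascal a k = *k!-cancel (suc k) (begin
  binomℕ a (suc k) * + (suc k !)                            ≡⟨ binomℕ-falling a (suc k) ⟩
  falling a (suc k)                                         ≡⟨ falling-pascal a k ⟩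
  falling (a - + 1) (suc k) + + suc k * falling (a - + 1) k
    ≡⟨ cong₂ (λ x y → x + + suc k * y) (binomℕ-falling (a - + 1) (suc k)) (binomℕ-falling (a - + 1) k) ⟨
  b₁ * + (suc k !) + + suc k * (b₀ * + (k !))
    ≡⟨ cong (λ x → b₁ * x + + suc k * (b₀ * + (k !))) k+1! ⟩
  b₁ * (+ suc k * + (k !)) + + suc k * (b₀ * + (k !))       ≡⟨ collect b₁ b₀ (+ suc k) (+ (k !)) ⟩
  (b₁ + b₀) * (+ suc k * + (k !))                           ≡⟨ cong ((b₁ + b₀) *_) k+1! ⟨
  (b₁ + b₀) * + (suc k !)                                   ∎)
  where
  open ≡-Reasoning
  b₁ = binomℕ (a - + 1) (suc k)
  b₀ = binomℕ (a - + 1) k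
  k+1! : + (suc k !) ≡ + suc k * + (k !)
  k+1! = ℤP.pos-* (suc k) (k !)
  collect : ∀ b c s f → b * (s * f) + s * (c * f) ≡ (b + c) * (s * f)
  collect = solve-∀

binom-pascal : ∀ a l → binom a l ≡ binom (a - + 1) l + binom (a - + 1) (l - + 1)
binom-pascal a (+ zero)  = refl
binom-pascal a (+ suc k) = binomℕ-pascal a k
binom-pascal a -[1+ n ]  = refl

binomℕ-absorption : ∀ a k → + suc k * binomℕ a (suc k) ≡ a * binomℕ (a - + 1) k
binomℕ-absorption a k = *k!-cancel k (begin
  (+ suc k * binomℕ a (suc k)) * + (k !)   ≡⟨ rearrange (+ suc k) (binomℕ a (suc k)) (+ (k !)) ⟩
  binomℕ a (suc k) * (+ suc k * + (k !))   ≡⟨ cong (binomℕ a (suc k) *_) (ℤP.pos-* (suc k) (k !)) ⟨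
  binomℕ a (suc k) * + (suc k !)           ≡⟨ binomℕ-falling a (suc k) ⟩
  falling a (suc k)                        ≡⟨ falling-suc a k ⟩
  a * falling (a - + 1) k                  ≡⟨ cong (a *_) (binomℕ-falling (a - + 1) k) ⟨
  a * (binomℕ (a - + 1) k * + (k !))       ≡⟨ ℤP.*-assoc a (binomℕ (a - + 1) k) (+ (k !)) ⟨
  (a * binomℕ (a - + 1) k) * + (k !)       ∎)
  where
  open ≡-Reasoning
  rearrange : ∀ s b f → (s * b) * f ≡ b * (s * f)
  rearrange = solve-∀

binomℕ-absorption′ : ∀ a k → (a - + k) * binomℕ a k ≡ a * binomℕ (a - + 1) k
binomℕ-absorption′ a k = *k!-cancel k (begin
  ((a - + k) * binomℕ a k) * + (k !)       ≡⟨ ℤP.*-assoc (a - + k) (binomℕ a k) (+ (k !)) ⟩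
  (a - + k) * (binomℕ a k * + (k !))       ≡⟨ cong ((a - + k) *_) (binomℕ-falling a k) ⟩
  (a - + k) * falling a k                  ≡⟨ ℤP.*-comm (a - + k) (falling a k) ⟩
  falling a (suc k)                        ≡⟨ falling-suc a k ⟩
  a * falling (a - + 1) k                  ≡⟨ cong (a *_) (binomℕ-falling (a - + 1) k) ⟨
  a * (binomℕ (a - + 1) k * + (k !))       ≡⟨ ℤP.*-assoc a (binomℕ (a - + 1) k) (+ (k !)) ⟨
  (a * binomℕ (a - + 1) k) * + (k !)       ∎)
  where open ≡-Reasoning

binom-above-top : ∀ a d → binom (+ a) (+ (suc a ℕ.+ d)) ≡ + 0
binom-above-top a d = trans (cong (λ x → _/ℕ_ x (k !) {{k ℕP.!≢0}}) (falling-vanishes d))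
                            (cong +_ (ℕD.0/n≡0 (k !) {{k ℕP.!≢0}}))
  where
  k = suc a ℕ.+ d
  falling-vanishes : ∀ d → falling (+ a) (suc a ℕ.+ d) ≡ + 0
  falling-vanishes zero    = trans (cong (falling (+ a)) (ℕP.+-identityʳ (suc a)))
    (trans (cong (falling (+ a) a *_) (ℤP.+-inverseʳ (+ a))) (ℤP.*-zeroʳ (falling (+ a) a)))
  falling-vanishes (suc d) = trans (cong (falling (+ a)) (ℕP.+-suc (suc a) d))
                                   (cong (_* (+ a - + (suc a ℕ.+ d))) (falling-vanishes d))

binom-below : ∀ a {m j} → m < j → binom a (+ m - + j) ≡ + 0
binom-below a {m} (s≤s {n = j} m≤j) with ℕP.m≤n⇒∃[o]m+o≡n m≤j
... | d , refl = cong (binom a) (trans (cong (λ x → + m - x) (ℤP.pos-+ (suc m) d)) (negative (+ m) (+ d)))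
  where
  negative : ∀ m d → m - (+ 1 + m + d) ≡ - (+ 1 + d)
  negative = solve-∀

-- Evaluation at α = 1 and the α-derivative there

-- `derivₚ` runs a local helper that cannot be referred to, and `derivFrom` is a copy of it.
-- `derivFrom-unique` identifies the two once `with` has turned the helper's arguments into
-- variables, so that Agda can solve for the helper by higher-order pattern unification.
derivFrom : ℕ → Poly → Poly
derivFrom k []      = []
derivFrom k (d ∷ q) = (+ k * d) ∷ derivFrom (suc k) q

derivFrom-unique : (g : Poly → ℕ → Poly → Poly) → (∀ p k → g p k [] ≡ []) →
                   (∀ p k d q → g p k (d ∷ q) ≡ (+ k * d) ∷ g p (suc k) q) →
                   ∀ p k q → g p k q ≡ derivFrom k q
derivFrom-unique g g[] g∷ p k []      = g[] p k
derivFrom-unique g g[] g∷ p k (d ∷ q) =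
  trans (g∷ p k d q) (cong (_ ∷_) (derivFrom-unique g g[] g∷ p (suc k) q))

derivₚ-∷∷ : ∀ c d q → derivₚ (c ∷ d ∷ q) ≡ (+ 1 * d) ∷ derivFrom 2 q
derivₚ-∷∷ c with derivFrom-unique _ (λ _ _ → refl) (λ _ _ _ _ → refl)
... | helper≡derivFrom = unfolded
  where
  unfolded : ∀ d q → derivₚ (c ∷ d ∷ q) ≡ (+ 1 * d) ∷ derivFrom 2 q
  unfolded d q with d ∷ q
  ... | p with 2 | q
  ...   | k | r = cong (_ ∷_) (helper≡derivFrom p k r)

derivₚ-∷ : ∀ c p → derivₚ (c ∷ p) ≡ derivFrom 1 p
derivₚ-∷ c []      = refl
derivₚ-∷ c (d ∷ q) = derivₚ-∷∷ c d q

eval1-derivFrom-suc : ∀ k q → eval1 (derivFrom (suc k) q) ≡ eval1 (derivFrom k q) + eval1 q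
eval1-derivFrom-suc k []      = refl
eval1-derivFrom-suc k (d ∷ q) =
  trans (cong (_+_ (+ suc k * d)) (eval1-derivFrom-suc (suc k) q))
        (regroup (+ k) d (eval1 (derivFrom (suc k) q)) (eval1 q))
  where
  regroup : ∀ k d a b → (+ 1 + k) * d + (a + b) ≡ (k * d + a) + (d + b)
  regroup = solve-∀

dα-at1-∷ : ∀ c p → dα-at1 (c ∷ p) ≡ dα-at1 p + eval1 p
dα-at1-∷ c p = begin
  eval1 (derivₚ (c ∷ p))            ≡⟨ cong eval1 (derivₚ-∷ c p) ⟩
  eval1 (derivFrom 1 p)             ≡⟨ eval1-derivFrom-suc 0 p ⟩
  eval1 (derivFrom 0 p) + eval1 p   ≡⟨ cong (_+ eval1 p) (derivFrom-0 p) ⟩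
  dα-at1 p + eval1 p                ∎
  where
  open ≡-Reasoning
  derivFrom-0 : ∀ p → eval1 (derivFrom 0 p) ≡ dα-at1 p
  derivFrom-0 []      = refl
  derivFrom-0 (d ∷ q) = trans (ℤP.+-identityˡ _) (cong eval1 (sym (derivₚ-∷ d q)))

eval1-+ₚ : ∀ p q → eval1 (p +ₚ q) ≡ eval1 p + eval1 q
eval1-+ₚ []      q       = sym (ℤP.+-identityˡ (eval1 q))
eval1-+ₚ (c ∷ p) []      = sym (ℤP.+-identityʳ (eval1 (c ∷ p)))
eval1-+ₚ (c ∷ p) (d ∷ q) =
  trans (cong (_+_ (c + d)) (eval1-+ₚ p q)) (interchange c d (eval1 p) (eval1 q))
  where
  interchange : ∀ a b c d → (a + b) + (c + d) ≡ (a + c) + (b + d)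
  interchange = solve-∀

dα-at1-+ₚ : ∀ p q → dα-at1 (p +ₚ q) ≡ dα-at1 p + dα-at1 q
dα-at1-+ₚ []      q       = sym (ℤP.+-identityˡ (dα-at1 q))
dα-at1-+ₚ (c ∷ p) []      = sym (ℤP.+-identityʳ (dα-at1 (c ∷ p)))
dα-at1-+ₚ (c ∷ p) (d ∷ q) = begin
  dα-at1 ((c + d) ∷ (p +ₚ q))       ≡⟨ dα-at1-∷ (c + d) (p +ₚ q) ⟩
  dα-at1 (p +ₚ q) + eval1 (p +ₚ q)  ≡⟨ cong₂ _+_ (dα-at1-+ₚ p q) (eval1-+ₚ p q) ⟩
  (Dp + Dq) + (Ep + Eq)             ≡⟨ interchange Dp Dq Ep Eq ⟩
  (Dp + Ep) + (Dq + Eq)             ≡⟨ cong₂ _+_ (dα-at1-∷ c p) (dα-at1-∷ d q) ⟨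
  dα-at1 (c ∷ p) + dα-at1 (d ∷ q)   ∎
  where
  open ≡-Reasoning
  Dp = dα-at1 p; Dq = dα-at1 q; Ep = eval1 p; Eq = eval1 q
  interchange : ∀ a b c d → (a + b) + (c + d) ≡ (a + c) + (b + d)
  interchange = solve-∀

eval1-·ₚ : ∀ a p → eval1 (a ·ₚ p) ≡ a * eval1 p
eval1-·ₚ a []      = sym (ℤP.*-zeroʳ a)
eval1-·ₚ a (c ∷ p) = trans (cong (_+_ (a * c)) (eval1-·ₚ a p)) (sym (ℤP.*-distribˡ-+ a c (eval1 p)))

dα-at1-·ₚ : ∀ a p → dα-at1 (a ·ₚ p) ≡ a * dα-at1 p
dα-at1-·ₚ a []      = sym (ℤP.*-zeroʳ a)
dα-at1-·ₚ a (c ∷ p) = begin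
  dα-at1 ((a * c) ∷ (a ·ₚ p))        ≡⟨ dα-at1-∷ (a * c) (a ·ₚ p) ⟩
  dα-at1 (a ·ₚ p) + eval1 (a ·ₚ p)   ≡⟨ cong₂ _+_ (dα-at1-·ₚ a p) (eval1-·ₚ a p) ⟩
  a * dα-at1 p + a * eval1 p         ≡⟨ ℤP.*-distribˡ-+ a (dα-at1 p) (eval1 p) ⟨
  a * (dα-at1 p + eval1 p)           ≡⟨ cong (a *_) (dα-at1-∷ c p) ⟨
  a * dα-at1 (c ∷ p)                 ∎
  where open ≡-Reasoning

eval1-*ₚ : ∀ p q → eval1 (p *ₚ q) ≡ eval1 p * eval1 q
eval1-*ₚ []      q = refl
eval1-*ₚ (c ∷ p) q = begin
  eval1 ((c ·ₚ q) +ₚ (+ 0 ∷ (p *ₚ q)))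
    ≡⟨ eval1-+ₚ (c ·ₚ q) (+ 0 ∷ (p *ₚ q)) ⟩
  eval1 (c ·ₚ q) + (+ 0 + eval1 (p *ₚ q))
    ≡⟨ cong₂ (λ x y → x + (+ 0 + y)) (eval1-·ₚ c q) (eval1-*ₚ p q) ⟩
  c * eval1 q + (+ 0 + eval1 p * eval1 q)
    ≡⟨ collect c (eval1 q) (eval1 p) ⟩
  (c + eval1 p) * eval1 q ∎
  where
  open ≡-Reasoning
  collect : ∀ c a b → c * a + (+ 0 + b * a) ≡ (c + b) * a
  collect = solve-∀

dα-at1-*ₚ : ∀ p q → dα-at1 (p *ₚ q) ≡ dα-at1 p * eval1 q + eval1 p * dα-at1 q
dα-at1-*ₚ []      q = refl
dα-at1-*ₚ (c ∷ p) q = begin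
  dα-at1 ((c ·ₚ q) +ₚ (+ 0 ∷ (p *ₚ q)))
    ≡⟨ dα-at1-+ₚ (c ·ₚ q) (+ 0 ∷ (p *ₚ q)) ⟩
  dα-at1 (c ·ₚ q) + dα-at1 (+ 0 ∷ (p *ₚ q))
    ≡⟨ cong (_+_ (dα-at1 (c ·ₚ q))) (dα-at1-∷ (+ 0) (p *ₚ q)) ⟩
  dα-at1 (c ·ₚ q) + (dα-at1 (p *ₚ q) + eval1 (p *ₚ q))
    ≡⟨ cong₂ _+_ (dα-at1-·ₚ c q) (cong₂ _+_ (dα-at1-*ₚ p q) (eval1-*ₚ p q)) ⟩
  c * Dq + ((Dp * Eq + Ep * Dq) + Ep * Eq)
    ≡⟨ collect c Dq Eq Dp Ep ⟩
  (Dp + Ep) * Eq + (c + Ep) * Dq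
    ≡⟨ cong (λ x → x * Eq + (c + Ep) * Dq) (dα-at1-∷ c p) ⟨
  dα-at1 (c ∷ p) * Eq + (c + Ep) * Dq ∎
  where
  open ≡-Reasoning
  Dp = dα-at1 p; Dq = dα-at1 q; Ep = eval1 p; Eq = eval1 q
  collect : ∀ c dq eq dp ep → c * dq + ((dp * eq + ep * dq) + ep * eq) ≡ (dp + ep) * eq + (c + ep) * dq
  collect = solve-∀

eval1--ₚ : ∀ p → eval1 (-ₚ p) ≡ - eval1 p
eval1--ₚ p = trans (eval1-·ₚ (- + 1) p) (ℤP.-1*i≡-i (eval1 p))

dα-at1--ₚ : ∀ p → dα-at1 (-ₚ p) ≡ - dα-at1 p
dα-at1--ₚ p = trans (dα-at1-·ₚ (- + 1) p) (ℤP.-1*i≡-i (dα-at1 p))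

eval1-≈ₚ : ∀ p q → p ≈ₚ q → eval1 p ≡ eval1 q
eval1-≈ₚ []      []      _   = refl
eval1-≈ₚ []      (d ∷ q) p≈q = cong₂ _+_ (p≈q 0) (eval1-≈ₚ [] q (λ k → p≈q (suc k)))
eval1-≈ₚ (c ∷ p) []      p≈q = cong₂ _+_ (p≈q 0) (eval1-≈ₚ p [] (λ k → p≈q (suc k)))
eval1-≈ₚ (c ∷ p) (d ∷ q) p≈q = cong₂ _+_ (p≈q 0) (eval1-≈ₚ p q (λ k → p≈q (suc k)))

dα-at1-≈ₚ : ∀ p q → p ≈ₚ q → dα-at1 p ≡ dα-at1 q
dα-at1-≈ₚ []      []      _   = refl
dα-at1-≈ₚ []      (d ∷ q) p≈q =
  trans (cong₂ _+_ (dα-at1-≈ₚ [] q (λ k → p≈q (suc k))) (eval1-≈ₚ [] q (λ k → p≈q (suc k))))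
        (sym (dα-at1-∷ d q))
dα-at1-≈ₚ (c ∷ p) []      p≈q =
  trans (dα-at1-∷ c p)
        (cong₂ _+_ (dα-at1-≈ₚ p [] (λ k → p≈q (suc k))) (eval1-≈ₚ p [] (λ k → p≈q (suc k))))
dα-at1-≈ₚ (c ∷ p) (d ∷ q) p≈q = trans (dα-at1-∷ c p)
  (trans (cong₂ _+_ (dα-at1-≈ₚ p q (λ k → p≈q (suc k))) (eval1-≈ₚ p q (λ k → p≈q (suc k))))
         (sym (dα-at1-∷ d q)))

∑≤ : (ℕ → ℤ) → ℕ → ℤ
∑≤ T zero    = T 0
∑≤ T (suc i) = ∑≤ T i + T (suc i)

⊛-as-sum : ∀ f g n → (f ⊛ g) n ≡ ∑≤ (λ j → f j * g (n ∸ j)) n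
⊛-as-sum f g zero    = refl
⊛-as-sum f g (suc n) =
  trans (cong (_+_ (f 0 * g (suc n))) (⊛-as-sum (tail f) g n)) (sym (split-first n))
  where
  split-first : ∀ i → ∑≤ (λ j → f j * g (suc n ∸ j)) (suc i)
                      ≡ f 0 * g (suc n) + ∑≤ (λ j → f (suc j) * g (n ∸ j)) i
  split-first zero    = refl
  split-first (suc i) = trans (cong (_+ f (2 ℕ.+ i) * g (n ∸ suc i)) (split-first i))
                              (ℤP.+-assoc (f 0 * g (suc n)) _ _)

-- `_*ₛ_` also runs a local helper; `cauchy-partial` is a copy of it, identified as above.
cauchy-partial : Series → Series → ℕ → ℕ → Poly
cauchy-partial F G n zero    = F 0 *ₚ G n
cauchy-partial F G n (suc i) = cauchy-partial F G n i +ₚ F (suc i) *ₚ G (n ∸ suc i)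

cauchy-partial-unique : ∀ F G (g : ℕ → ℕ → Poly) → (∀ n → g n 0 ≡ F 0 *ₚ G n) →
                        (∀ n i → g n (suc i) ≡ g n i +ₚ F (suc i) *ₚ G (n ∸ suc i)) →
                        ∀ n i → g n i ≡ cauchy-partial F G n i
cauchy-partial-unique F G g g0 gs n zero    = g0 n
cauchy-partial-unique F G g g0 gs n (suc i) =
  trans (gs n i) (cong (_+ₚ F (suc i) *ₚ G (n ∸ suc i)) (cauchy-partial-unique F G g g0 gs n i))

*ₛ-as-cauchy-partial : ∀ F G n → (F *ₛ G) n ≡ cauchy-partial F G n n
*ₛ-as-cauchy-partial F G with cauchy-partial-unique F G _ (λ _ → refl) (λ _ _ → refl)
... | helper≡partial = unfolded
  where
  unfolded : ∀ n → (F *ₛ G) n ≡ cauchy-partial F G n n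
  unfolded zero    = refl
  unfolded (suc m) with suc m
  ... | n with m
  ...   | i = cong (_+ₚ F n *ₚ G (i ∸ i)) (helper≡partial n i)

eval1ₛ dα-at1ₛ : Series → ℤ⟦z⟧
eval1ₛ  F n = eval1 (F n)
dα-at1ₛ F n = dα-at1 (F n)

eval1ₛ-*ₛ : ∀ F G → eval1ₛ (F *ₛ G) ≈ eval1ₛ F ⊛ eval1ₛ G
eval1ₛ-*ₛ F G n = trans (cong eval1 (*ₛ-as-cauchy-partial F G n))
                        (trans (partial n) (sym (⊛-as-sum (eval1ₛ F) (eval1ₛ G) n)))
  where
  partial : ∀ i → eval1 (cauchy-partial F G n i) ≡ ∑≤ (λ j → eval1ₛ F j * eval1ₛ G (n ∸ j)) i
  partial zero    = eval1-*ₚ (F 0) (G n)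
  partial (suc i) = trans (eval1-+ₚ (cauchy-partial F G n i) (F (suc i) *ₚ G (n ∸ suc i)))
                          (cong₂ _+_ (partial i) (eval1-*ₚ (F (suc i)) (G (n ∸ suc i))))

dα-at1ₛ-*ₛ : ∀ F G → dα-at1ₛ (F *ₛ G) ≈ dα-at1ₛ F ⊛ eval1ₛ G ⊕ eval1ₛ F ⊛ dα-at1ₛ G
dα-at1ₛ-*ₛ F G n = trans (cong dα-at1 (*ₛ-as-cauchy-partial F G n)) (trans (partial n)
  (sym (cong₂ _+_ (⊛-as-sum (dα-at1ₛ F) (eval1ₛ G) n) (⊛-as-sum (eval1ₛ F) (dα-at1ₛ G) n))))
  where
  ∑′ ∑″ : ℕ → ℤ
  ∑′ = ∑≤ (λ j → dα-at1ₛ F j * eval1ₛ G (n ∸ j))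
  ∑″ = ∑≤ (λ j → eval1ₛ F j * dα-at1ₛ G (n ∸ j))
  interchange : ∀ a b c d → (a + b) + (c + d) ≡ (a + c) + (b + d)
  interchange = solve-∀
  partial : ∀ i → dα-at1 (cauchy-partial F G n i) ≡ ∑′ i + ∑″ i
  partial zero    = dα-at1-*ₚ (F 0) (G n)
  partial (suc i) = begin
    dα-at1 (cauchy-partial F G n i +ₚ F (suc i) *ₚ G (n ∸ suc i))
      ≡⟨ dα-at1-+ₚ (cauchy-partial F G n i) (F (suc i) *ₚ G (n ∸ suc i)) ⟩
    dα-at1 (cauchy-partial F G n i) + dα-at1 (F (suc i) *ₚ G (n ∸ suc i))
      ≡⟨ cong₂ _+_ (partial i) (dα-at1-*ₚ (F (suc i)) (G (n ∸ suc i))) ⟩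
    (∑′ i + ∑″ i) + (a + b)           ≡⟨ interchange (∑′ i) (∑″ i) a b ⟩
    ∑′ (suc i) + ∑″ (suc i)           ∎
    where
    open ≡-Reasoning
    a = dα-at1ₛ F (suc i) * eval1ₛ G (n ∸ suc i)
    b = eval1ₛ F (suc i) * dα-at1ₛ G (n ∸ suc i)

eval1ₛ-+ₛ : ∀ F G → eval1ₛ (F +ₛ G) ≈ eval1ₛ F ⊕ eval1ₛ G
eval1ₛ-+ₛ F G n = eval1-+ₚ (F n) (G n)

dα-at1ₛ-+ₛ : ∀ F G → dα-at1ₛ (F +ₛ G) ≈ dα-at1ₛ F ⊕ dα-at1ₛ G
dα-at1ₛ-+ₛ F G n = dα-at1-+ₚ (F n) (G n)

eval1ₛ--ₛ : ∀ F G → eval1ₛ (F -ₛ G) ≈ eval1ₛ F ⊖ eval1ₛ G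
eval1ₛ--ₛ F G n = trans (eval1-+ₚ (F n) (-ₚ G n)) (cong (_+_ (eval1 (F n))) (eval1--ₚ (G n)))

dα-at1ₛ--ₛ : ∀ F G → dα-at1ₛ (F -ₛ G) ≈ dα-at1ₛ F ⊖ dα-at1ₛ G
dα-at1ₛ--ₛ F G n = trans (dα-at1-+ₚ (F n) (-ₚ G n)) (cong (_+_ (dα-at1 (F n))) (dα-at1--ₚ (G n)))

eval1ₛ-·ₛ : ∀ p F → eval1ₛ (p ·ₛ F) ≈ cst (eval1 p) ⊛ eval1ₛ F
eval1ₛ-·ₛ p F n = trans (eval1-*ₚ p (F n)) (sym (cst⊛ (eval1 p) (eval1ₛ F) n))

dα-at1ₛ-·ₛ : ∀ p F → dα-at1ₛ (p ·ₛ F) ≈ cst (dα-at1 p) ⊛ eval1ₛ F ⊕ cst (eval1 p) ⊛ dα-at1ₛ F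
dα-at1ₛ-·ₛ p F n = trans (dα-at1-*ₚ p (F n))
  (sym (cong₂ _+_ (cst⊛ (dα-at1 p) (eval1ₛ F) n) (cst⊛ (eval1 p) (dα-at1ₛ F) n)))

eval1ₛ-zₛ : ∀ F → eval1ₛ (zₛ F) ≈ z ⊛ eval1ₛ F
eval1ₛ-zₛ F zero    = refl
eval1ₛ-zₛ F (suc n) = sym (z⊛-suc (eval1ₛ F) n)

dα-at1ₛ-zₛ : ∀ F → dα-at1ₛ (zₛ F) ≈ z ⊛ dα-at1ₛ F
dα-at1ₛ-zₛ F zero    = refl
dα-at1ₛ-zₛ F (suc n) = sym (z⊛-suc (dα-at1ₛ F) n)

eval1ₛ-constₛ : ∀ p → eval1ₛ (constₛ p) ≈ cst (eval1 p)
eval1ₛ-constₛ p zero    = refl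
eval1ₛ-constₛ p (suc n) = refl

dα-at1ₛ-constₛ : ∀ p → dα-at1ₛ (constₛ p) ≈ cst (dα-at1 p)
dα-at1ₛ-constₛ p zero    = refl
dα-at1ₛ-constₛ p (suc n) = refl

eval1ₛ-≈ₛ : ∀ F G → F ≈ₛ G → eval1ₛ F ≈ eval1ₛ G
eval1ₛ-≈ₛ F G F≈G n = eval1-≈ₚ (F n) (G n) (F≈G n)

dα-at1ₛ-≈ₛ : ∀ F G → F ≈ₛ G → dα-at1ₛ F ≈ dα-at1ₛ G
dα-at1ₛ-≈ₛ F G F≈G n = dα-at1-≈ₚ (F n) (G n) (F≈G n)

eval1ₛ-^ₛ : ∀ F t → eval1ₛ (F ^ₛ t) ≈ eval1ₛ F ^ t
eval1ₛ-^ₛ F zero    = eval1ₛ-constₛ (constₚ (+ 1))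
eval1ₛ-^ₛ F (suc t) = ≈-trans (eval1ₛ-*ₛ F (F ^ₛ t)) (⊛-cong ≈-refl (eval1ₛ-^ₛ F t))

-- Stated after multiplication by eval1ₛ F, so that the case t = 0 needs no t - 1.
dα-at1ₛ-^ₛ : ∀ F t → eval1ₛ F ⊛ dα-at1ₛ (F ^ₛ t) ≈ cst (+ t) ⊛ dα-at1ₛ F ⊛ eval1ₛ F ^ t
dα-at1ₛ-^ₛ F zero    = linear-combination (eval1ₛ F by dα-at1ₛ-constₛ (constₚ (+ 1)))
  (solve 3 (λ E D D⁰ → E :* D⁰ :- con (+ 0) :* D :* con (+ 1) := E :* (D⁰ :- con (+ 0)))
    ≈-refl (eval1ₛ F) (dα-at1ₛ F) (dα-at1ₛ (F ^ₛ 0)))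
dα-at1ₛ-^ₛ F (suc t) = linear-combination
  (E by dα-at1ₛ-*ₛ F (F ^ₛ t) ⊹ E ⊛ D by eval1ₛ-^ₛ F t ⊹ E by dα-at1ₛ-^ₛ F t
   ⊹ ⊝ (D ⊛ E ⊛ E ^ t) by cst-+ (+ 1) (+ t))
  (solve 8 (λ E D Eᵗ Eᵗ′ Dᵗ Dᵗ⁺¹ T T+1 →
      E :* Dᵗ⁺¹ :- T+1 :* D :* (E :* Eᵗ)
   := E :* (Dᵗ⁺¹ :- (D :* Eᵗ′ :+ E :* Dᵗ)) :+ E :* D :* (Eᵗ′ :- Eᵗ)
      :+ E :* (E :* Dᵗ :- T :* D :* Eᵗ) :+ :- (D :* E :* Eᵗ) :* (T+1 :- (con (+ 1) :+ T)))
    ≈-refl E D (E ^ t) (eval1ₛ (F ^ₛ t)) (dα-at1ₛ (F ^ₛ t)) (dα-at1ₛ (F ^ₛ suc t))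
           (cst (+ t)) (cst (+ suc t)))
  where
  E = eval1ₛ F
  D = dα-at1ₛ F

z/[1-z] : ℤ⟦z⟧
z/[1-z] = eval1ₛ z/1-z

[1-z]⊛z/[1-z] : (𝟙 ⊖ z) ⊛ z/[1-z] ≈ z
[1-z]⊛z/[1-z] = linear-combination (𝟙 by recurrence)
  (solve 2 (λ z w → (con (+ 1) :- z) :* w :- z := con (+ 1) :* (w :- (z :+ z :* w))) ≈-refl z z/[1-z])
  where
  recurrence : z/[1-z] ≈ z ⊕ z ⊛ z/[1-z]
  recurrence zero          = refl
  recurrence (suc zero)    = sym (cong (_+_ (+ 1)) (z⊛-suc z/[1-z] 0))
  recurrence (suc (suc n)) = sym (cong (_+_ (+ 0)) (z⊛-suc z/[1-z] (suc n)))

dα-at1ₛ-z/1-z^ₛ : ∀ t → dα-at1ₛ (z/1-z ^ₛ t) ≈ 𝟘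
dα-at1ₛ-z/1-z^ₛ zero    = dα-at1ₛ-constₛ (constₚ (+ 1))
dα-at1ₛ-z/1-z^ₛ (suc t) = linear-combination
  (Wᵗ by dα-at1ₛ-z/1-z ⊹ z/[1-z] by dα-at1ₛ-z/1-z^ₛ t ⊹ 𝟙 by dα-at1ₛ-*ₛ z/1-z (z/1-z ^ₛ t))
  (solve 5 (λ W Wᵗ D Dᵗ Dᵗ⁺¹ →
      Dᵗ⁺¹ :- con (+ 0)
   := Wᵗ :* (D :- con (+ 0)) :+ W :* (Dᵗ :- con (+ 0)) :+ con (+ 1) :* (Dᵗ⁺¹ :- (D :* Wᵗ :+ W :* Dᵗ)))
    ≈-refl z/[1-z] Wᵗ (dα-at1ₛ z/1-z) (dα-at1ₛ (z/1-z ^ₛ t)) (dα-at1ₛ (z/1-z ^ₛ suc t)))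
  where
  Wᵗ = eval1ₛ (z/1-z ^ₛ t)
  dα-at1ₛ-z/1-z : dα-at1ₛ z/1-z ≈ 𝟘
  dα-at1ₛ-z/1-z zero    = refl
  dα-at1ₛ-z/1-z (suc n) = refl

-- Generating functions of binomial coefficients

central : ℤ → ℤ⟦z⟧
central o n = binom (+ 2 * + n + o) (+ n)

central-cong : ∀ {o o′} → o ≡ o′ → central o ≈ central o′
central-cong refl = ≈-refl

central-pascal : ∀ o → central o ≈ central (o - + 1) ⊕ z ⊛ central (o + + 1)
central-pascal o zero    = refl
central-pascal o (suc m) = trans (binom-pascal (+ 2 * + suc m + o) (+ suc m)) (cong₂ _+_
  (cong (λ a → binom a (+ suc m)) (upper₁ (+ m) o))
  (trans (cong (λ a → binom a (+ m)) (upper₂ (+ m) o)) (sym (z⊛-suc (central (o + + 1)) m))))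
  where
  upper₁ : ∀ m o → (+ 2 * (+ 1 + m) + o) - + 1 ≡ + 2 * (+ 1 + m) + (o - + 1)
  upper₁ = solve-∀
  upper₂ : ∀ m o → (+ 2 * (+ 1 + m) + o) - + 1 ≡ + 2 * m + (o + + 1)
  upper₂ = solve-∀

central-recurrence : ∀ m → + suc m * central (+ 0) (suc m) ≡ (+ 4 * + m + + 2) * central (+ 0) m
central-recurrence m = ℤP.*-cancelˡ-≡ (+ suc m) _ _ (begin
  + suc m * (+ suc m * binomℕ a (suc m))  ≡⟨ cong (+ suc m *_) (binomℕ-absorption a m) ⟩
  + suc m * (a * binomℕ (a - + 1) m)      ≡⟨ cong (λ x → + suc m * (a * binomℕ x m)) (a-1 (+ m)) ⟩
  + suc m * (a * binomℕ a′ m)             ≡⟨ swap (+ suc m) a (binomℕ a′ m) ⟩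
  a * (+ suc m * binomℕ a′ m)             ≡⟨ cong (λ x → a * (x * binomℕ a′ m)) (a′-m (+ m)) ⟩
  a * ((a′ - + m) * binomℕ a′ m)          ≡⟨ cong (a *_) (binomℕ-absorption′ a′ m) ⟩
  a * (a′ * binomℕ (a′ - + 1) m)          ≡⟨ cong (λ x → a * (a′ * binomℕ x m)) (a′-1 (+ m)) ⟩
  a * (a′ * central (+ 0) m)              ≡⟨ collect (+ m) (central (+ 0) m) ⟩
  + suc m * ((+ 4 * + m + + 2) * central (+ 0) m) ∎)
  where
  open ≡-Reasoning
  a a′ : ℤ
  a  = + 2 * + suc m + + 0
  a′ = + 2 * + m + + 1
  a-1 : ∀ m → + 2 * (+ 1 + m) + + 0 - + 1 ≡ + 2 * m + + 1
  a-1 = solve-∀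
  a′-m : ∀ m → + 1 + m ≡ + 2 * m + + 1 - m
  a′-m = solve-∀
  a′-1 : ∀ m → + 2 * m + + 1 - + 1 ≡ + 2 * m + + 0
  a′-1 = solve-∀
  swap : ∀ s a b → s * (a * b) ≡ a * (s * b)
  swap = solve-∀
  collect : ∀ m c → (+ 2 * (+ 1 + m) + + 0) * ((+ 2 * m + + 1) * c) ≡ (+ 1 + m) * ((+ 4 * m + + 2) * c)
  collect = solve-∀

central-one : ∀ m → + 2 * central (+ 1) m ≡ central (+ 0) (suc m)
central-one m = ℤP.*-cancelˡ-≡ (+ suc m) _ _ (begin
  + suc m * (+ 2 * binomℕ (+ 2 * + m + + 1) m)  ≡⟨ rearrange (+ m) (binomℕ (+ 2 * + m + + 1) m) ⟩
  a * binomℕ (+ 2 * + m + + 1) m                ≡⟨ cong (λ x → a * binomℕ x m) (a-1 (+ m)) ⟨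
  a * binomℕ (a - + 1) m                        ≡⟨ binomℕ-absorption a m ⟨
  + suc m * binomℕ a (suc m)                    ∎)
  where
  open ≡-Reasoning
  a : ℤ
  a = + 2 * + suc m + + 0
  a-1 : ∀ m → + 2 * (+ 1 + m) + + 0 - + 1 ≡ + 2 * m + + 1
  a-1 = solve-∀
  rearrange : ∀ m b → (+ 1 + m) * (+ 2 * b) ≡ (+ 2 * (+ 1 + m) + + 0) * b
  rearrange = solve-∀

θ-central : θ (central (+ 0)) ≈ z ⊛ (cst (+ 4) ⊛ θ (central (+ 0)) ⊕ cst (+ 2) ⊛ central (+ 0))
θ-central zero    = refl
θ-central (suc m) = trans (central-recurrence m) (sym (begin
  (z ⊛ (cst (+ 4) ⊛ θ A ⊕ cst (+ 2) ⊛ A)) (suc m)  ≡⟨ z⊛-suc (cst (+ 4) ⊛ θ A ⊕ cst (+ 2) ⊛ A) m ⟩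
  (cst (+ 4) ⊛ θ A) m + (cst (+ 2) ⊛ A) m          ≡⟨ cong₂ _+_ (cst⊛ (+ 4) (θ A) m) (cst⊛ (+ 2) A m) ⟩
  + 4 * (+ m * A m) + + 2 * A m                    ≡⟨ collect (+ m) (A m) ⟩
  (+ 4 * + m + + 2) * A m                          ∎))
  where
  open ≡-Reasoning
  A = central (+ 0)
  collect : ∀ m a → + 4 * (m * a) + + 2 * a ≡ (+ 4 * m + + 2) * a
  collect = solve-∀

z⊛central-one : cst (+ 2) ⊛ (z ⊛ central (+ 1)) ≈ central (+ 0) ⊖ 𝟙
z⊛central-one zero    = refl
z⊛central-one (suc m) = begin
  (cst (+ 2) ⊛ (z ⊛ central (+ 1))) (suc m)  ≡⟨ cst⊛ (+ 2) (z ⊛ central (+ 1)) (suc m) ⟩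
  + 2 * (z ⊛ central (+ 1)) (suc m)          ≡⟨ cong (+ 2 *_) (z⊛-suc (central (+ 1)) m) ⟩
  + 2 * central (+ 1) m                      ≡⟨ central-one m ⟩
  central (+ 0) (suc m)                      ≡⟨ ℤP.+-identityʳ _ ⟨
  central (+ 0) (suc m) + - 𝟙 (suc m)        ∎
  where open ≡-Reasoning

z^-shift : ∀ j {f g} → (∀ m → m < j → f m ≡ + 0) → (∀ n → f (n ℕ.+ j) ≡ g n) → f ≈ z ^ j ⊛ g
z^-shift zero    {f} {g} _     shifted n =
  trans (cong f (sym (ℕP.+-identityʳ n))) (trans (shifted n) (sym (⊛-identityˡ g n)))
z^-shift (suc j) {f} {g} below shifted =
  ≈-trans f≈z⊛tail (≈-trans (⊛-cong ≈-refl tail≈) (≈-sym (⊛-assoc z (z ^ j) g)))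
  where
  tail≈ : tail f ≈ z ^ j ⊛ g
  tail≈ = z^-shift j (λ m m<j → below (suc m) (s≤s m<j))
                     (λ n → trans (cong f (sym (ℕP.+-suc n j))) (shifted n))
  f≈z⊛tail : f ≈ z ⊛ tail f
  f≈z⊛tail zero    = below 0 (s≤s z≤n)
  f≈z⊛tail (suc n) = sym (z⊛-suc (tail f) n)

S : ℕ → ℤ⟦z⟧
S j n = binom (+ 2 * + n - + 5) (+ n - + j)

S-as-central : ∀ i → S (suc i) ≈ z ^ suc i ⊛ central (+ (i ℕ.+ i) - + 3)
S-as-central i = z^-shift (suc i) (λ m m<1+i → binom-below _ m<1+i) (λ n → cong₂ binom (upper n) (lower n))
  where
  upper : ∀ n → + 2 * + (n ℕ.+ suc i) - + 5 ≡ + 2 * + n + (+ (i ℕ.+ i) - + 3)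
  upper n = trans (cong (λ x → + 2 * x - + 5) (ℤP.pos-+ n (suc i)))
                  (trans (arith (+ n) (+ i)) (cong (λ x → + 2 * + n + (x - + 3)) (sym (ℤP.pos-+ i i))))
    where
    arith : ∀ n i → + 2 * (n + (+ 1 + i)) - + 5 ≡ + 2 * n + ((i + i) - + 3)
    arith = solve-∀
  lower : ∀ n → + (n ℕ.+ suc i) - + suc i ≡ + n
  lower n = trans (cong (_- + suc i) (ℤP.pos-+ n (suc i))) (cancel (+ n) (+ i))
    where
    cancel : ∀ n i → (n + (+ 1 + i)) - (+ 1 + i) ≡ n
    cancel = solve-∀

E : ℕ → ℤ⟦z⟧
E t n = binom (+ n - + 3) (+ n - + t - + 1)

E-recurrence : ∀ t → E (suc t) ≈ z ⊛ E t ⊕ z ⊛ E (suc t)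
E-recurrence t zero    = refl
E-recurrence t (suc m) = trans (binom-pascal (+ suc m - + 3) (+ suc m - + suc t - + 1)) (cong₂ _+_
  (trans (cong₂ binom (upper (+ m)) (lower₁ (+ m) (+ t))) (sym (z⊛-suc (E t) m)))
  (trans (cong₂ binom (upper (+ m)) (lower₂ (+ m) (+ t))) (sym (z⊛-suc (E (suc t)) m))))
  where
  upper : ∀ m → (+ 1 + m - + 3) - + 1 ≡ m - + 3
  upper = solve-∀
  lower₁ : ∀ m t → + 1 + m - (+ 1 + t) - + 1 ≡ m - t - + 1
  lower₁ = solve-∀
  lower₂ : ∀ m t → (+ 1 + m - (+ 1 + t) - + 1) - + 1 ≡ m - (+ 1 + t) - + 1
  lower₂ = solve-∀

E-zero : E 0 ≈ z ⊛ (𝟙 ⊖ z)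
E-zero zero                = refl
E-zero (suc zero)          = refl
E-zero (suc (suc zero))    = refl
E-zero (suc (suc (suc m))) =
  trans (cong₂ binom (upper (+ m)) (trans (lower (+ m)) (sym (ℤP.pos-+ (suc m) 1))))
        (trans (binom-above-top m 1) (sym (z⊛-suc (𝟙 ⊖ z) (suc (suc m)))))
  where
  upper : ∀ m → + 3 + m - + 3 ≡ m
  upper = solve-∀
  lower : ∀ m → + 3 + m - + 0 - + 1 ≡ + 1 + m + + 1
  lower = solve-∀

E-gf : ∀ t → E t ≈ z ⊛ (𝟙 ⊖ z) ⊛ z/[1-z] ^ t
E-gf zero    = ≈-trans E-zero (≈-sym (⊛-identityʳ (z ⊛ (𝟙 ⊖ z))))
E-gf (suc t) = ⊛-cancelˡ {𝟙 ⊖ z} (λ ()) (linear-combination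
  (𝟙 by E-recurrence t ⊹ z by E-gf t ⊹ ⊝ (z ⊛ (𝟙 ⊖ z) ⊛ z/[1-z] ^ t) by [1-z]⊛z/[1-z])
  (solve 5 (λ z w Wᵗ E₀ E₁ →
      (con (+ 1) :- z) :* E₁ :- (con (+ 1) :- z) :* (z :* (con (+ 1) :- z) :* (w :* Wᵗ))
   := con (+ 1) :* (E₁ :- (z :* E₀ :+ z :* E₁)) :+ z :* (E₀ :- z :* (con (+ 1) :- z) :* Wᵗ)
      :+ :- (z :* (con (+ 1) :- z) :* Wᵗ) :* ((con (+ 1) :- z) :* w :- z))
    ≈-refl z z/[1-z] (z/[1-z] ^ t) (E t) (E (suc t))))

RHS : ℕ → ℤ⟦z⟧
RHS t = S (1 ℕ.+ t) ⊕ θ (S (3 ℕ.+ t)) ⊖ cst (+ 3) ⊛ S (3 ℕ.+ t) ⊖ θ (S (4 ℕ.+ t)) ⊖ E t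

RHS-coefficient : ∀ t n → RHS t n ≡ binom (+ 2 * + n - + 5) (+ n - + t - + 1)
                                   + (+ n - + 3) * binom (+ 2 * + n - + 5) (+ n - + t - + 3)
                                   - + n * binom (+ 2 * + n - + 5) (+ n - + t - + 4)
                                   - binom (+ n - + 3) (+ n - + t - + 1)
RHS-coefficient t n = begin
  b (1 ℕ.+ t) + + n * b (3 ℕ.+ t) - (cst (+ 3) ⊛ S (3 ℕ.+ t)) n - + n * b (4 ℕ.+ t) - E t n
    ≡⟨ cong (λ x → b (1 ℕ.+ t) + + n * b (3 ℕ.+ t) - x - + n * b (4 ℕ.+ t) - E t n)
            (cst⊛ (+ 3) (S (3 ℕ.+ t)) n) ⟩
  b (1 ℕ.+ t) + + n * b (3 ℕ.+ t) - + 3 * b (3 ℕ.+ t) - + n * b (4 ℕ.+ t) - E t n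
    ≡⟨ cong₂ (λ x y → x + + n * y - + 3 * y - + n * b (4 ℕ.+ t) - E t n) (shift 1) (shift 3) ⟩
  b′ 1 + + n * b′ 3 - + 3 * b′ 3 - + n * b (4 ℕ.+ t) - E t n
    ≡⟨ cong (λ x → b′ 1 + + n * b′ 3 - + 3 * b′ 3 - + n * x - E t n) (shift 4) ⟩
  b′ 1 + + n * b′ 3 - + 3 * b′ 3 - + n * b′ 4 - E t n
    ≡⟨ collect (b′ 1) (b′ 3) (b′ 4) (E t n) (+ n) ⟩
  b′ 1 + (+ n - + 3) * b′ 3 - + n * b′ 4 - E t n ∎
  where
  open ≡-Reasoning
  b b′ : ℕ → ℤ
  b  j = binom (+ 2 * + n - + 5) (+ n - + j)
  b′ k = binom (+ 2 * + n - + 5) (+ n - + t - + k)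
  shift : ∀ k → b (k ℕ.+ t) ≡ b′ k
  shift k = cong (binom (+ 2 * + n - + 5)) (trans (cong (_-_ (+ n)) (ℤP.pos-+ k t)) (reassociate (+ n) (+ k) (+ t)))
    where
    reassociate : ∀ n k t → n - (k + t) ≡ n - t - k
    reassociate = solve-∀
  collect : ∀ a b c e n → a + n * b - + 3 * b - n * c - e ≡ a + (n - + 3) * b - n * c - e
  collect = solve-∀

-- Series in the Catalan series u = z (1 + u)²

module Catalan (u : ℤ⟦z⟧) (catalan : u ≈ z ⊛ (𝟙 ⊕ u) ^ 2) where

  C D : ℤ⟦z⟧
  C = 𝟙 ⊕ u
  D = 𝟙 ⊖ u

  u0≡0 : u 0 ≡ + 0
  u0≡0 = catalan 0

  C0≡1 : C 0 ≡ + 1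
  C0≡1 = cong (_+_ (+ 1)) u0≡0

  D0≡1 : D 0 ≡ + 1
  D0≡1 = cong (_-_ (+ 1)) u0≡0

  θu-equation : θ u ⊛ D ≈ u ⊛ C
  θu-equation = linear-combination
    (C by θ-cong catalan ⊹ C by θ-⊛ z (C ^ 2) ⊹ C ⊛ C ^ 2 by θ-z ⊹ C ⊛ z by θ-^ C 1
     ⊹ C ⊛ cst (+ 2) ⊛ z ⊛ C by θ-cst⊕ (+ 1) u ⊹ ⊝ (C ⊕ cst (+ 2) ⊛ θ u) by catalan)
    (solve 7 (λ z u θu θC θzC² θz θC² → let C = con (+ 1) :+ u in
        θu :* (con (+ 1) :- u) :- u :* C
     := C :* (θu :- θzC²) :+ C :* (θzC² :- (θz :* C :^ 2 :+ z :* θC²)) :+ C :* C :^ 2 :* (θz :- z)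
        :+ C :* z :* (θC² :- con (+ 2) :* C :^ 1 :* θC) :+ C :* con (+ 2) :* z :* C :* (θC :- θu)
        :+ :- (C :+ con (+ 2) :* θu) :* (u :- z :* C :^ 2))
      ≈-refl z u (θ u) (θ C) (θ (z ⊛ C ^ 2)) (θ z) (θ (C ^ 2)))

  -- Both sides solve θY = u (θY + Y) and have constant term 1.
  central-gf : central (+ 0) ⊛ D ≈ C
  central-gf = θ-equation-unique u0≡0 constant-terms
    (linear-combination
      (D by θ-⊛ A D ⊹ A ⊛ D by θ-cst⊖ (+ 1) u ⊹ ⊝ A by θu-equation ⊹ C ^ 2 by θ-central
       ⊹ ⊝ (cst (+ 4) ⊛ θ A ⊕ cst (+ 2) ⊛ A) by catalan)
      (solve 7 (λ z u θu θD A θA θ[AD] → let C = con (+ 1) :+ u; D = con (+ 1) :- u in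
          θ[AD] :- u :* (θ[AD] :+ A :* D)
       := D :* (θ[AD] :- (θA :* D :+ A :* θD)) :+ A :* D :* (θD :- :- θu) :+ :- A :* (θu :* D :- u :* C)
          :+ C :^ 2 :* (θA :- z :* (con (+ 4) :* θA :+ con (+ 2) :* A))
          :+ :- (con (+ 4) :* θA :+ con (+ 2) :* A) :* (u :- z :* C :^ 2))
        ≈-refl z u (θ u) (θ D) A (θ A) (θ (A ⊛ D))))
    (linear-combination (D by θ-cst⊕ (+ 1) u ⊹ 𝟙 by θu-equation)
      (solve 3 (λ u θu θC → let C = con (+ 1) :+ u; D = con (+ 1) :- u in
          θC :- u :* (θC :+ C) := D :* (θC :- θu) :+ con (+ 1) :* (θu :* D :- u :* C))
        ≈-refl u (θ u) (θ C)))
    where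
    A = central (+ 0)
    constant-terms : (A ⊛ D) 0 ≡ C 0
    constant-terms = trans (cong (+ 1 *_) D0≡1) (sym C0≡1)

  -- Σₙ binom(2n + o, n) zⁿ = (1 + u)^(o+1) / (1 - u), written for o = k - 3 with the
  -- denominators cleared, so that it also covers the offsets o = -2 and o = -3.
  CentralGF : ℕ → Set
  CentralGF k = central (+ k - + 3) ⊛ D ⊛ C ^ 2 ≈ C ^ k

  central-step : ∀ k → central (+ suc k - + 3) ≈ central (+ k - + 3) ⊕ z ⊛ central (+ suc (suc k) - + 3)
  central-step k = ≈-trans (central-pascal (+ suc k - + 3))
    (⊕-cong (central-cong (down (+ k))) (⊛-cong (≈-refl {z}) (central-cong (up (+ k)))))
    where
    down : ∀ k → (+ 1 + k - + 3) - + 1 ≡ k - + 3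
    down = solve-∀
    up : ∀ k → (+ 1 + k - + 3) + + 1 ≡ + 2 + k - + 3
    up = solve-∀

  central-gf₃ : CentralGF 3
  central-gf₃ = linear-combination (C ^ 2 by central-gf)
    (solve 2 (λ u A → let C = con (+ 1) :+ u; D = con (+ 1) :- u in
        A :* D :* C :^ 2 :- C :^ 3 := C :^ 2 :* (A :* D :- C))
      ≈-refl u (central (+ 0)))

  central-gf₄ : CentralGF 4
  central-gf₄ = z⊛-cancel (⊛-cancelˡ {cst (+ 2)} (λ ()) (linear-combination
    (D ⊛ C ^ 2 by z⊛central-one ⊹ C ^ 2 by central-gf ⊹ cst (+ 2) ⊛ C ^ 2 by catalan)
    (solve 4 (λ z u A B → let C = con (+ 1) :+ u; D = con (+ 1) :- u in
        con (+ 2) :* (z :* (B :* D :* C :^ 2)) :- con (+ 2) :* (z :* C :^ 4)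
     := D :* C :^ 2 :* (con (+ 2) :* (z :* B) :- (A :- con (+ 1))) :+ C :^ 2 :* (A :* D :- C)
        :+ con (+ 2) :* C :^ 2 :* (u :- z :* C :^ 2))
      ≈-refl z u (central (+ 0)) (central (+ 1)))))

  central-gf-up : ∀ k → CentralGF k → CentralGF (1 ℕ.+ k) → CentralGF (2 ℕ.+ k)
  central-gf-up k gfₖ gfₖ₊₁ = z⊛-cancel (linear-combination
    (⊝ (D ⊛ C ^ 2) by central-step k ⊹ 𝟙 by gfₖ₊₁ ⊹ ⊝ 𝟙 by gfₖ ⊹ C ^ k by catalan)
    (solve 6 (λ z u Bₖ Bₖ₊₁ Bₖ₊₂ Cᵏ → let C = con (+ 1) :+ u; D = con (+ 1) :- u in
        z :* (Bₖ₊₂ :* D :* C :^ 2) :- z :* (C :* (C :* Cᵏ))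
     := :- (D :* C :^ 2) :* (Bₖ₊₁ :- (Bₖ :+ z :* Bₖ₊₂))
        :+ con (+ 1) :* (Bₖ₊₁ :* D :* C :^ 2 :- C :* Cᵏ)
        :+ :- con (+ 1) :* (Bₖ :* D :* C :^ 2 :- Cᵏ) :+ Cᵏ :* (u :- z :* C :^ 2))
      ≈-refl z u (central (+ k - + 3)) (central (+ suc k - + 3)) (central (+ suc (suc k) - + 3)) (C ^ k)))

  central-gf-down : ∀ k → CentralGF (1 ℕ.+ k) → CentralGF (2 ℕ.+ k) → CentralGF k
  central-gf-down k gfₖ₊₁ gfₖ₊₂ = linear-combination
    (⊝ (D ⊛ C ^ 2) by central-step k ⊹ 𝟙 by gfₖ₊₁ ⊹ ⊝ z by gfₖ₊₂ ⊹ C ^ k by catalan)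
    (solve 6 (λ z u Bₖ Bₖ₊₁ Bₖ₊₂ Cᵏ → let C = con (+ 1) :+ u; D = con (+ 1) :- u in
        Bₖ :* D :* C :^ 2 :- Cᵏ
     := :- (D :* C :^ 2) :* (Bₖ₊₁ :- (Bₖ :+ z :* Bₖ₊₂))
        :+ con (+ 1) :* (Bₖ₊₁ :* D :* C :^ 2 :- C :* Cᵏ)
        :+ :- z :* (Bₖ₊₂ :* D :* C :^ 2 :- C :* (C :* Cᵏ)) :+ Cᵏ :* (u :- z :* C :^ 2))
      ≈-refl z u (central (+ k - + 3)) (central (+ suc k - + 3)) (central (+ suc (suc k) - + 3)) (C ^ k))

  central-gf₂ : CentralGF 2
  central-gf₂ = central-gf-down 2 central-gf₃ central-gf₄

  central-gf₁ : CentralGF 1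
  central-gf₁ = central-gf-down 1 central-gf₂ central-gf₃

  central-gf-all : ∀ k → CentralGF k
  central-gf-all 0                   = central-gf-down 0 central-gf₁ central-gf₂
  central-gf-all 1                   = central-gf₁
  central-gf-all 2                   = central-gf₂
  central-gf-all (suc (suc (suc m))) = proj₁ (from-3 m)
    where
    from-3 : ∀ m → CentralGF (3 ℕ.+ m) × CentralGF (4 ℕ.+ m)
    from-3 zero    = central-gf₃ , central-gf₄
    from-3 (suc m) with from-3 m
    ... | gfₘ , gfₘ₊₁ = gfₘ₊₁ , central-gf-up (3 ℕ.+ m) gfₘ gfₘ₊₁

  u^-equation : ∀ i → u ^ i ≈ z ^ i ⊛ C ^ i ⊛ C ^ i
  u^-equation zero    = ≈-sym (≈-trans (⊛-identityʳ (𝟙 ⊛ 𝟙)) (⊛-identityʳ 𝟙))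
  u^-equation (suc i) = linear-combination (u by u^-equation i ⊹ z ^ i ⊛ C ^ i ⊛ C ^ i by catalan)
    (solve 5 (λ z u uⁱ zⁱ Cⁱ → let C = con (+ 1) :+ u in
        u :* uⁱ :- z :* zⁱ :* (C :* Cⁱ) :* (C :* Cⁱ)
     := u :* (uⁱ :- zⁱ :* Cⁱ :* Cⁱ) :+ zⁱ :* Cⁱ :* Cⁱ :* (u :- z :* C :^ 2))
      ≈-refl z u (u ^ i) (z ^ i) (C ^ i))

  S-gf : ∀ i → S (suc i) ⊛ D ⊛ C ^ 4 ≈ u ^ suc i
  S-gf i = linear-combination
    (D ⊛ C ^ 4 by S-as-central i ⊹ z ^ suc i ⊛ C ^ 2 by central-gf-all (i ℕ.+ i)
     ⊹ z ^ suc i ⊛ C ^ 2 by ^-+ C i i ⊹ ⊝ 𝟙 by u^-equation (suc i))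
    (solve 7 (λ u Sᵢ zⁱ⁺¹ B Cⁱ Cⁱ⁺ⁱ uⁱ⁺¹ → let C = con (+ 1) :+ u; D = con (+ 1) :- u in
        Sᵢ :* D :* C :^ 4 :- uⁱ⁺¹
     := D :* C :^ 4 :* (Sᵢ :- zⁱ⁺¹ :* B) :+ zⁱ⁺¹ :* C :^ 2 :* (B :* D :* C :^ 2 :- Cⁱ⁺ⁱ)
        :+ zⁱ⁺¹ :* C :^ 2 :* (Cⁱ⁺ⁱ :- Cⁱ :* Cⁱ)
        :+ :- con (+ 1) :* (uⁱ⁺¹ :- zⁱ⁺¹ :* (C :* Cⁱ) :* (C :* Cⁱ)))
      ≈-refl u (S (suc i)) (z ^ suc i) (central (+ (i ℕ.+ i) - + 3)) (C ^ i) (C ^ (i ℕ.+ i)) (u ^ suc i))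

  θS-gf : ∀ i → θ (S (suc i)) ⊛ D ^ 3 ⊛ C ^ 4
                ≈ cst (+ suc i) ⊛ u ^ suc i ⊛ C ⊛ D ⊖ u ^ suc (suc i) ⊛ (cst (+ 3) ⊖ cst (+ 5) ⊛ u)
  θS-gf i = linear-combination
    (D ^ 2 by θ-cong (S-gf i) ⊹ D ^ 2 by θ-^ u i ⊹ ⊝ D ^ 2 by θ-⊛ (Sᵢ ⊛ D) (C ^ 4)
     ⊹ ⊝ (D ^ 2 ⊛ C ^ 4) by θ-⊛ Sᵢ D ⊹ ⊝ (D ^ 2 ⊛ Sᵢ ⊛ C ^ 4) by θ-cst⊖ (+ 1) u
     ⊹ ⊝ (D ^ 2 ⊛ Sᵢ ⊛ D) by θ-^ C 3 ⊹ ⊝ (cst (+ 4) ⊛ D ^ 2 ⊛ Sᵢ ⊛ D ⊛ C ^ 3) by θ-cst⊕ (+ 1) u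
     ⊹ D ⊛ cst (+ suc i) ⊛ u ^ i ⊕ D ⊛ Sᵢ ⊛ C ^ 4 ⊖ cst (+ 4) ⊛ Sᵢ ⊛ D ^ 2 ⊛ C ^ 3 by θu-equation
     ⊹ u ⊛ C ⊖ cst (+ 4) ⊛ u ⊛ D by S-gf i)
    (solve 12 (λ u θu Sᵢ θSᵢ uⁱ T θ[SDC⁴] θ[SD] θD θ[C⁴] θC θuⁱ⁺¹ →
          let C = con (+ 1) :+ u; D = con (+ 1) :- u in
        θSᵢ :* D :^ 3 :* C :^ 4 :- (T :* (u :* uⁱ) :* C :* D :- u :* (u :* uⁱ) :* (con (+ 3) :- con (+ 5) :* u))
     := D :^ 2 :* (θ[SDC⁴] :- θuⁱ⁺¹) :+ D :^ 2 :* (θuⁱ⁺¹ :- T :* uⁱ :* θu)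
        :+ :- D :^ 2 :* (θ[SDC⁴] :- (θ[SD] :* C :^ 4 :+ Sᵢ :* D :* θ[C⁴]))
        :+ :- (D :^ 2 :* C :^ 4) :* (θ[SD] :- (θSᵢ :* D :+ Sᵢ :* θD))
        :+ :- (D :^ 2 :* Sᵢ :* C :^ 4) :* (θD :- :- θu)
        :+ :- (D :^ 2 :* Sᵢ :* D) :* (θ[C⁴] :- con (+ 4) :* C :^ 3 :* θC)
        :+ :- (con (+ 4) :* D :^ 2 :* Sᵢ :* D :* C :^ 3) :* (θC :- θu)
        :+ (D :* T :* uⁱ :+ D :* Sᵢ :* C :^ 4 :- con (+ 4) :* Sᵢ :* D :^ 2 :* C :^ 3) :* (θu :* D :- u :* C)
        :+ (u :* C :- con (+ 4) :* u :* D) :* (Sᵢ :* D :* C :^ 4 :- u :* uⁱ))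
      ≈-refl u (θ u) Sᵢ (θ Sᵢ) (u ^ i) (cst (+ suc i)) (θ (Sᵢ ⊛ D ⊛ C ^ 4)) (θ (Sᵢ ⊛ D)) (θ D)
             (θ (C ^ 4)) (θ C) (θ (u ^ suc i)))
    where
    Sᵢ = S (suc i)

  module Derivative (t : ℕ) {v q q′ : ℤ⟦z⟧}
    (v-equation  : v ⊛ D ≈ z ⊛ u ^ 2 ⊛ C)
    (q-equation  : q ⊛ C ^ 2 ≈ u ⊛ (u ^ t ⊖ z/[1-z] ^ t))
    (q′-equation : q′ ⊛ C ^ 2 ⊕ q ⊛ C ⊛ (u ⊕ cst (+ 2) ⊛ v)
                   ≈ (u ⊕ v) ⊛ (u ^ t ⊖ z/[1-z] ^ t) ⊕ cst (+ t) ⊛ v ⊛ u ^ t)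
    where

    Uᵗ Wᵗ : ℤ⟦z⟧
    Uᵗ = u ^ t
    Wᵗ = z/[1-z] ^ t

    q′-closed-form : q′ ⊛ D ⊛ C ^ 4
                     ≈ (Uᵗ ⊖ Wᵗ) ⊛ u ⊛ (𝟙 ⊕ u ⊕ u ^ 2) ⊛ D ⊕ cst (+ t) ⊛ Uᵗ ⊛ u ^ 3 ⊛ C
    q′-closed-form = linear-combination
      (D ⊛ C ^ 2 by q′-equation ⊹ ⊝ (D ⊛ C ⊛ (u ⊕ cst (+ 2) ⊛ v)) by q-equation
       ⊹ C ^ 2 ⊛ (Uᵗ ⊖ Wᵗ) ⊕ C ^ 2 ⊛ cst (+ t) ⊛ Uᵗ ⊖ cst (+ 2) ⊛ C ⊛ u ⊛ (Uᵗ ⊖ Wᵗ)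
         by v-equation
       ⊹ ⊝ (u ^ 2 ⊛ C ⊛ (Uᵗ ⊖ Wᵗ)) ⊕ cst (+ 2) ⊛ u ^ 3 ⊛ (Uᵗ ⊖ Wᵗ) ⊖ cst (+ t) ⊛ Uᵗ ⊛ u ^ 2 ⊛ C
         by catalan)
      (solve 8 (λ z u v q q′ Uᵗ Wᵗ T → let C = con (+ 1) :+ u; D = con (+ 1) :- u in
          q′ :* D :* C :^ 4 :- ((Uᵗ :- Wᵗ) :* u :* (con (+ 1) :+ u :+ u :^ 2) :* D :+ T :* Uᵗ :* u :^ 3 :* C)
       := D :* C :^ 2 :* (q′ :* C :^ 2 :+ q :* C :* (u :+ con (+ 2) :* v)
                          :- ((u :+ v) :* (Uᵗ :- Wᵗ) :+ T :* v :* Uᵗ))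
          :+ :- (D :* C :* (u :+ con (+ 2) :* v)) :* (q :* C :^ 2 :- u :* (Uᵗ :- Wᵗ))
          :+ (C :^ 2 :* (Uᵗ :- Wᵗ) :+ C :^ 2 :* T :* Uᵗ :- con (+ 2) :* C :* u :* (Uᵗ :- Wᵗ))
             :* (v :* D :- z :* u :^ 2 :* C)
          :+ (:- (u :^ 2 :* C :* (Uᵗ :- Wᵗ)) :+ con (+ 2) :* u :^ 3 :* (Uᵗ :- Wᵗ) :- T :* Uᵗ :* u :^ 2 :* C)
             :* (u :- z :* C :^ 2))
        ≈-refl z u v q q′ Uᵗ Wᵗ (cst (+ t)))

    q′≈RHS : q′ ≈ RHS t
    q′≈RHS = ⊛-cancelˡ {D ^ 3 ⊛ C ^ 4} D³C⁴0≢0 (linear-combination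
      (D ^ 2 by q′-closed-form ⊹ ⊝ (D ^ 2) by S-gf t ⊹ ⊝ 𝟙 by θS-gf (2 ℕ.+ t)
       ⊹ cst (+ 3) ⊛ D ^ 2 by S-gf (2 ℕ.+ t) ⊹ 𝟙 by θS-gf (3 ℕ.+ t) ⊹ D ^ 3 ⊛ C ^ 4 by E-gf t
       ⊹ D ^ 3 ⊛ Wᵗ ⊛ (u ⊖ C ^ 2 ⊕ z ⊛ C ^ 2) by catalan
       ⊹ ⊝ (u ^ 3 ⊛ Uᵗ ⊛ C ⊛ D) by cst-+ (+ 3) (+ t) ⊹ u ^ 4 ⊛ Uᵗ ⊛ C ⊛ D by cst-+ (+ 4) (+ t))
      (solve 13 (λ z u q′ Uᵗ Wᵗ T T₃ T₄ S₁ S₃ θS₃ θS₄ Eₜ →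
            let C = con (+ 1) :+ u; D = con (+ 1) :- u; u³Uᵗ = u :* (u :* (u :* Uᵗ)) in
          D :^ 3 :* C :^ 4 :* q′ :- D :^ 3 :* C :^ 4 :* (S₁ :+ θS₃ :- con (+ 3) :* S₃ :- θS₄ :- Eₜ)
       := D :^ 2 :* (q′ :* D :* C :^ 4
                     :- ((Uᵗ :- Wᵗ) :* u :* (con (+ 1) :+ u :+ u :^ 2) :* D :+ T :* Uᵗ :* u :^ 3 :* C))
          :+ :- (D :^ 2) :* (S₁ :* D :* C :^ 4 :- u :* Uᵗ)
          :+ :- con (+ 1) :* (θS₃ :* D :^ 3 :* C :^ 4
                              :- (T₃ :* u³Uᵗ :* C :* D :- u :* u³Uᵗ :* (con (+ 3) :- con (+ 5) :* u)))
          :+ con (+ 3) :* D :^ 2 :* (S₃ :* D :* C :^ 4 :- u³Uᵗ)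
          :+ con (+ 1) :* (θS₄ :* D :^ 3 :* C :^ 4
                           :- (T₄ :* (u :* u³Uᵗ) :* C :* D :- u :* (u :* u³Uᵗ) :* (con (+ 3) :- con (+ 5) :* u)))
          :+ D :^ 3 :* C :^ 4 :* (Eₜ :- z :* (con (+ 1) :- z) :* Wᵗ)
          :+ D :^ 3 :* Wᵗ :* (u :- C :^ 2 :+ z :* C :^ 2) :* (u :- z :* C :^ 2)
          :+ :- (u :^ 3 :* Uᵗ :* C :* D) :* (T₃ :- (con (+ 3) :+ T))
          :+ u :^ 4 :* Uᵗ :* C :* D :* (T₄ :- (con (+ 4) :+ T)))
        ≈-refl z u q′ Uᵗ Wᵗ (cst (+ t)) (cst (+ (3 ℕ.+ t))) (cst (+ (4 ℕ.+ t)))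
               (S (1 ℕ.+ t)) (S (3 ℕ.+ t)) (θ (S (3 ℕ.+ t))) (θ (S (4 ℕ.+ t))) (E t)))
      where
      D³C⁴0≢0 : (D ^ 3 ⊛ C ^ 4) 0 ≢ + 0
      D³C⁴0≢0 eq with trans (sym (cong₂ _*_ (^-constant-term {D} D0≡1 3) (^-constant-term {C} C0≡1 4))) eq
      ... | ()

-- The hypotheses of the theorem at α = 1

module AtOne (t : ℕ) (M : Series)
  (M-equation : M ≈ₛ (oneₛ +ₛ (constₚ (+ 2) ·ₛ zₛ M) +ₛ (αₚ ·ₛ zₛ (zₛ (M *ₛ M)))))
  (Q : Series)
  (Q-equation : (Q *ₛ ((oneₛ +ₛ (αₚ ·ₛ zₛ M)) *ₛ (oneₛ +ₛ zₛ M)))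
                  ≈ₛ (αₚ ·ₛ (zₛ M *ₛ ((zₛ M ^ₛ t) -ₛ (z/1-z ^ₛ t)))))
  where

  m m′ u v q q′ : ℤ⟦z⟧
  m  = eval1ₛ M
  m′ = dα-at1ₛ M
  u  = eval1ₛ (zₛ M)
  v  = dα-at1ₛ (zₛ M)
  q  = eval1ₛ Q
  q′ = dα-at1ₛ Q

  zM zzM² M-rhs Den₁ Den₂ Den Diff Num : Series
  zM    = zₛ M
  zzM²  = zₛ (zₛ (M *ₛ M))
  M-rhs = oneₛ +ₛ constₚ (+ 2) ·ₛ zM +ₛ αₚ ·ₛ zzM²
  Den₁  = oneₛ +ₛ αₚ ·ₛ zM
  Den₂  = oneₛ +ₛ zM
  Den   = Den₁ *ₛ Den₂
  Diff  = zM ^ₛ t -ₛ z/1-z ^ₛ t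
  Num   = zM *ₛ Diff

  zₛ²-eval : ∀ (e : Series → ℤ⟦z⟧) → (∀ F → e (zₛ F) ≈ z ⊛ e F) →
             ∀ {f} → e (M *ₛ M) ≈ f → e zzM² ≈ z ⊛ (z ⊛ f)
  zₛ²-eval e e-zₛ eM² =
    ≈-trans (e-zₛ (zₛ (M *ₛ M))) (⊛-cong ≈-refl (≈-trans (e-zₛ (M *ₛ M)) (⊛-cong ≈-refl eM²)))

  m-equation : m ≈ 𝟙 ⊕ cst (+ 2) ⊛ (z ⊛ m) ⊕ cst (+ 1) ⊛ (z ⊛ (z ⊛ (m ⊛ m)))
  m-equation = ≈-trans (eval1ₛ-≈ₛ M M-rhs M-equation)
    (≈-trans (eval1ₛ-+ₛ (oneₛ +ₛ constₚ (+ 2) ·ₛ zM) (αₚ ·ₛ zzM²)) (⊕-cong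
      (≈-trans (eval1ₛ-+ₛ oneₛ (constₚ (+ 2) ·ₛ zM)) (⊕-cong (eval1ₛ-constₛ (constₚ (+ 1)))
        (≈-trans (eval1ₛ-·ₛ (constₚ (+ 2)) zM) (⊛-cong ≈-refl (eval1ₛ-zₛ M)))))
      (≈-trans (eval1ₛ-·ₛ αₚ zzM²)
               (⊛-cong ≈-refl (zₛ²-eval eval1ₛ eval1ₛ-zₛ (eval1ₛ-*ₛ M M))))))

  m′-equation : m′ ≈ 𝟘 ⊕ (cst (+ 0) ⊛ (z ⊛ m) ⊕ cst (+ 2) ⊛ (z ⊛ m′))
                     ⊕ (cst (+ 1) ⊛ (z ⊛ (z ⊛ (m ⊛ m)))
                        ⊕ cst (+ 1) ⊛ (z ⊛ (z ⊛ (m′ ⊛ m ⊕ m ⊛ m′))))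
  m′-equation = ≈-trans (dα-at1ₛ-≈ₛ M M-rhs M-equation)
    (≈-trans (dα-at1ₛ-+ₛ (oneₛ +ₛ constₚ (+ 2) ·ₛ zM) (αₚ ·ₛ zzM²)) (⊕-cong
      (≈-trans (dα-at1ₛ-+ₛ oneₛ (constₚ (+ 2) ·ₛ zM)) (⊕-cong (dα-at1ₛ-constₛ (constₚ (+ 1)))
        (≈-trans (dα-at1ₛ-·ₛ (constₚ (+ 2)) zM)
                 (⊕-cong (⊛-cong ≈-refl (eval1ₛ-zₛ M)) (⊛-cong ≈-refl (dα-at1ₛ-zₛ M))))))
      (≈-trans (dα-at1ₛ-·ₛ αₚ zzM²)
               (⊕-cong (⊛-cong ≈-refl (zₛ²-eval eval1ₛ eval1ₛ-zₛ (eval1ₛ-*ₛ M M)))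
                       (⊛-cong ≈-refl (zₛ²-eval dα-at1ₛ dα-at1ₛ-zₛ (dα-at1ₛ-*ₛ M M)))))))

  catalan : u ≈ z ⊛ (𝟙 ⊕ u) ^ 2
  catalan = linear-combination (𝟙 ⊖ z ⊛ (cst (+ 2) ⊕ u ⊕ z ⊛ m) by eval1ₛ-zₛ M ⊹ z by m-equation)
    (solve 3 (λ z m u →
        u :- z :* (con (+ 1) :+ u) :^ 2
     := (con (+ 1) :- z :* (con (+ 2) :+ u :+ z :* m)) :* (u :- z :* m)
        :+ z :* (m :- (con (+ 1) :+ con (+ 2) :* (z :* m) :+ con (+ 1) :* (z :* (z :* (m :* m))))))
      ≈-refl z m u)

  v-equation : v ⊛ (𝟙 ⊖ u) ≈ z ⊛ u ^ 2 ⊛ (𝟙 ⊕ u)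
  v-equation = linear-combination
    ((𝟙 ⊕ u) ⊛ (𝟙 ⊖ cst (+ 2) ⊛ z ⊖ cst (+ 2) ⊛ z ⊛ z ⊛ m) by dα-at1ₛ-zₛ M
     ⊹ (𝟙 ⊕ u) ⊛ z by m′-equation
     ⊹ ⊝ ((𝟙 ⊕ u) ⊛ (z ⊛ (u ⊕ z ⊛ m) ⊕ cst (+ 2) ⊛ z ⊛ v)) by eval1ₛ-zₛ M
     ⊹ ⊝ (cst (+ 2) ⊛ v) by catalan)
    (solve 5 (λ z m m′ u v → let C = con (+ 1) :+ u in
        v :* (con (+ 1) :- u) :- z :* u :^ 2 :* C
     := C :* (con (+ 1) :- con (+ 2) :* z :- con (+ 2) :* z :* z :* m) :* (v :- z :* m′)
        :+ C :* z :* (m′ :- (con (+ 0) :+ (con (+ 0) :* (z :* m) :+ con (+ 2) :* (z :* m′))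
                             :+ (con (+ 1) :* (z :* (z :* (m :* m)))
                                 :+ con (+ 1) :* (z :* (z :* (m′ :* m :+ m :* m′))))))
        :+ :- (C :* (z :* (u :+ z :* m) :+ con (+ 2) :* z :* v)) :* (u :- z :* m)
        :+ :- (con (+ 2) :* v) :* (u :- z :* C :^ 2))
      ≈-refl z m m′ u v)

  eval1-Den₁ : eval1ₛ Den₁ ≈ 𝟙 ⊕ cst (+ 1) ⊛ u
  eval1-Den₁ = ≈-trans (eval1ₛ-+ₛ oneₛ (αₚ ·ₛ zM))
                       (⊕-cong (eval1ₛ-constₛ (constₚ (+ 1))) (eval1ₛ-·ₛ αₚ zM))

  dα-Den₁ : dα-at1ₛ Den₁ ≈ 𝟘 ⊕ (cst (+ 1) ⊛ u ⊕ cst (+ 1) ⊛ v)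
  dα-Den₁ = ≈-trans (dα-at1ₛ-+ₛ oneₛ (αₚ ·ₛ zM))
                    (⊕-cong (dα-at1ₛ-constₛ (constₚ (+ 1))) (dα-at1ₛ-·ₛ αₚ zM))

  eval1-Den₂ : eval1ₛ Den₂ ≈ 𝟙 ⊕ u
  eval1-Den₂ = ≈-trans (eval1ₛ-+ₛ oneₛ zM) (⊕-cong (eval1ₛ-constₛ (constₚ (+ 1))) ≈-refl)

  dα-Den₂ : dα-at1ₛ Den₂ ≈ 𝟘 ⊕ v
  dα-Den₂ = ≈-trans (dα-at1ₛ-+ₛ oneₛ zM) (⊕-cong (dα-at1ₛ-constₛ (constₚ (+ 1))) ≈-refl)

  eval1-Diff : eval1ₛ Diff ≈ u ^ t ⊖ z/[1-z] ^ t
  eval1-Diff = ≈-trans (eval1ₛ--ₛ (zM ^ₛ t) (z/1-z ^ₛ t))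
                       (⊕-cong (eval1ₛ-^ₛ zM t) (⊝-cong (eval1ₛ-^ₛ z/1-z t)))

  dα-Diff : dα-at1ₛ Diff ≈ dα-at1ₛ (zM ^ₛ t) ⊖ 𝟘
  dα-Diff = ≈-trans (dα-at1ₛ--ₛ (zM ^ₛ t) (z/1-z ^ₛ t))
                    (⊕-cong (≈-refl {dα-at1ₛ (zM ^ₛ t)}) (⊝-cong (dα-at1ₛ-z/1-z^ₛ t)))

  eval1-Den : eval1ₛ Den ≈ (𝟙 ⊕ cst (+ 1) ⊛ u) ⊛ (𝟙 ⊕ u)
  eval1-Den = ≈-trans (eval1ₛ-*ₛ Den₁ Den₂) (⊛-cong eval1-Den₁ eval1-Den₂)

  dα-Den : dα-at1ₛ Den ≈ (𝟘 ⊕ (cst (+ 1) ⊛ u ⊕ cst (+ 1) ⊛ v)) ⊛ (𝟙 ⊕ u) ⊕ (𝟙 ⊕ cst (+ 1) ⊛ u) ⊛ (𝟘 ⊕ v)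
  dα-Den = ≈-trans (dα-at1ₛ-*ₛ Den₁ Den₂)
                   (⊕-cong (⊛-cong dα-Den₁ eval1-Den₂) (⊛-cong eval1-Den₁ dα-Den₂))

  eval1-Num : eval1ₛ Num ≈ u ⊛ (u ^ t ⊖ z/[1-z] ^ t)
  eval1-Num = ≈-trans (eval1ₛ-*ₛ zM Diff) (⊛-cong ≈-refl eval1-Diff)

  dα-Num : dα-at1ₛ Num ≈ v ⊛ (u ^ t ⊖ z/[1-z] ^ t) ⊕ u ⊛ (dα-at1ₛ (zM ^ₛ t) ⊖ 𝟘)
  dα-Num = ≈-trans (dα-at1ₛ-*ₛ zM Diff) (⊕-cong (⊛-cong ≈-refl eval1-Diff) (⊛-cong ≈-refl dα-Diff))

  q-equation : q ⊛ (𝟙 ⊕ u) ^ 2 ≈ u ⊛ (u ^ t ⊖ z/[1-z] ^ t)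
  q-equation = linear-combination (𝟙 by evaluated)
    (solve 4 (λ q u Uᵗ Wᵗ → let C = con (+ 1) :+ u in
        q :* C :^ 2 :- u :* (Uᵗ :- Wᵗ)
     := con (+ 1) :* (q :* ((con (+ 1) :+ con (+ 1) :* u) :* C) :- con (+ 1) :* (u :* (Uᵗ :- Wᵗ))))
      ≈-refl q u (u ^ t) (z/[1-z] ^ t))
    where
    evaluated : q ⊛ ((𝟙 ⊕ cst (+ 1) ⊛ u) ⊛ (𝟙 ⊕ u)) ≈ cst (+ 1) ⊛ (u ⊛ (u ^ t ⊖ z/[1-z] ^ t))
    evaluated = begin
      q ⊛ ((𝟙 ⊕ cst (+ 1) ⊛ u) ⊛ (𝟙 ⊕ u))      ≈⟨ ⊛-cong ≈-refl eval1-Den ⟨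
      q ⊛ eval1ₛ Den                           ≈⟨ eval1ₛ-*ₛ Q Den ⟨
      eval1ₛ (Q *ₛ Den)                        ≈⟨ eval1ₛ-≈ₛ (Q *ₛ Den) (αₚ ·ₛ Num) Q-equation ⟩
      eval1ₛ (αₚ ·ₛ Num)                       ≈⟨ eval1ₛ-·ₛ αₚ Num ⟩
      cst (+ 1) ⊛ eval1ₛ Num                   ≈⟨ ⊛-cong ≈-refl eval1-Num ⟩
      cst (+ 1) ⊛ (u ⊛ (u ^ t ⊖ z/[1-z] ^ t))  ∎
      where open ≈-Reasoning

  q′-equation : q′ ⊛ (𝟙 ⊕ u) ^ 2 ⊕ q ⊛ (𝟙 ⊕ u) ⊛ (u ⊕ cst (+ 2) ⊛ v)
                ≈ (u ⊕ v) ⊛ (u ^ t ⊖ z/[1-z] ^ t) ⊕ cst (+ t) ⊛ v ⊛ u ^ t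
  q′-equation = linear-combination (𝟙 by differentiated ⊹ 𝟙 by dα-at1ₛ-^ₛ zM t)
    (solve 8 (λ q q′ u v Uᵗ Wᵗ T P′ → let C = con (+ 1) :+ u in
        q′ :* C :^ 2 :+ q :* C :* (u :+ con (+ 2) :* v) :- ((u :+ v) :* (Uᵗ :- Wᵗ) :+ T :* v :* Uᵗ)
     := con (+ 1) :* (q′ :* ((con (+ 1) :+ con (+ 1) :* u) :* C)
                      :+ q :* ((con (+ 0) :+ (con (+ 1) :* u :+ con (+ 1) :* v)) :* C
                               :+ (con (+ 1) :+ con (+ 1) :* u) :* (con (+ 0) :+ v))
                      :- (con (+ 1) :* (u :* (Uᵗ :- Wᵗ))
                          :+ con (+ 1) :* (v :* (Uᵗ :- Wᵗ) :+ u :* (P′ :- con (+ 0)))))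
        :+ con (+ 1) :* (u :* P′ :- T :* v :* Uᵗ))
      ≈-refl q q′ u v (u ^ t) (z/[1-z] ^ t) (cst (+ t)) (dα-at1ₛ (zM ^ₛ t)))
    where
    differentiated : q′ ⊛ ((𝟙 ⊕ cst (+ 1) ⊛ u) ⊛ (𝟙 ⊕ u))
                     ⊕ q ⊛ ((𝟘 ⊕ (cst (+ 1) ⊛ u ⊕ cst (+ 1) ⊛ v)) ⊛ (𝟙 ⊕ u)
                            ⊕ (𝟙 ⊕ cst (+ 1) ⊛ u) ⊛ (𝟘 ⊕ v))
                     ≈ cst (+ 1) ⊛ (u ⊛ (u ^ t ⊖ z/[1-z] ^ t))
                       ⊕ cst (+ 1) ⊛ (v ⊛ (u ^ t ⊖ z/[1-z] ^ t) ⊕ u ⊛ (dα-at1ₛ (zM ^ₛ t) ⊖ 𝟘))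
    differentiated = begin
      _                                         ≈⟨ ⊕-cong (⊛-cong ≈-refl eval1-Den) (⊛-cong ≈-refl dα-Den) ⟨
      q′ ⊛ eval1ₛ Den ⊕ q ⊛ dα-at1ₛ Den         ≈⟨ dα-at1ₛ-*ₛ Q Den ⟨
      dα-at1ₛ (Q *ₛ Den)                        ≈⟨ dα-at1ₛ-≈ₛ (Q *ₛ Den) (αₚ ·ₛ Num) Q-equation ⟩
      dα-at1ₛ (αₚ ·ₛ Num)                       ≈⟨ dα-at1ₛ-·ₛ αₚ Num ⟩
      cst (+ 1) ⊛ eval1ₛ Num ⊕ cst (+ 1) ⊛ dα-at1ₛ Num
                                                ≈⟨ ⊕-cong (⊛-cong ≈-refl eval1-Num) (⊛-cong ≈-refl dα-Num) ⟩
      _                                         ∎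
      where open ≈-Reasoning

lemma18 : (t n : ℕ) → 1 ≤ n →
    (M : Series) →
    M ≈ₛ (oneₛ +ₛ (constₚ (+ 2) ·ₛ zₛ M) +ₛ (αₚ ·ₛ zₛ (zₛ (M *ₛ M)))) →
    (Q : Series) →
    (Q *ₛ ((oneₛ +ₛ (αₚ ·ₛ zₛ M)) *ₛ (oneₛ +ₛ zₛ M)))
      ≈ₛ (αₚ ·ₛ (zₛ M *ₛ ((zₛ M ^ₛ t) -ₛ (z/1-z ^ₛ t)))) →
    dα-at1 (Q n)
      ≡ binom (+ 2 * + n - + 5) (+ n - + t - + 1)
        + (+ n - + 3) * binom (+ 2 * + n - + 5) (+ n - + t - + 3)
        - + n * binom (+ 2 * + n - + 5) (+ n - + t - + 4)
        - binom (+ n - + 3) (+ n - + t - + 1)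
lemma18 t n _ M M-equation Q Q-equation = begin
  dα-at1 (Q n)   ≡⟨ q′≈RHS n ⟩
  RHS t n        ≡⟨ RHS-coefficient t n ⟩
  _              ∎
  where
  open ≡-Reasoning
  open AtOne t M M-equation Q Q-equation
  open Catalan u catalan
  open Derivative t v-equation q-equation q′-equation
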